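{- Let $r\ge2$, let $s_1,\dots,s_r,n$ be independent indeterminates over $\mathbb{Q}$, $\varphi(t)=1+s_1t+\cdots+s_rt^r$, and \[ R_1=n\,S_r\big(r\varphi(t)-t\varphi'(t)\big)-S_r(\varphi(t))\,\mathrm{diag}(r-1,r-2,\dots,1,0). \] Then \[ R_1^{ -1}=\frac1n\,Q\!\left(\frac{r-1}{r},\frac{r-2}{r},\dots,\frac1r,\frac0r\right)\mathrm{diag}(\zeta_1,\dots,\zeta_r)\,P\!\left(-\frac{2r-1}{r},-\frac{2r-2}{r},\dots,-\frac{r+1}{r},-\frac rr\right), \] where $\zeta_i=\frac{n}{rn-(r-i)}$ for $1\le i\le r$.
   Context: For $\lambda\in\mathbb{C}$ and $\ell\in\mathbb{Z}$, $\beta_\ell(\lambda)$ is the coefficient of $t^\ell$ in the power series $\varphi(t)^\lambda$ (so $\beta_0(\lambda)=1$ and $\beta_\ell(\lambda)=0$ for $\ell<0$). For $\lambda_1,\dots,\lambda_m$, $P(\lambda_1,\dots,\lambda_m)$ is the $m\times m$ matrix with $(i,j)$ entry $\beta_{i-j}(\lambda_i)$; for $\mu_1,\dots,\mu_m$, $Q(\mu_1,\dots,\mu_m)$ is the $m\times m$ matrix with $(i,j)$ entry $\beta_{i-j}(\mu_j)$. For a power series $\psi(t)=a_0+a_1t+\cdots$, $S_m(\psi(t))$ is the $m\times m$ matrix with $(i,j)$ entry $a_{i-j}$ (with $a_i=0$ for $i<0$). Here $m=r$. -}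

module Defs where

open import Level using (Level; _⊔_) renaming (suc to lsuc)
open import Algebra.Bundles using (CommutativeRing)
open import Data.Nat using (ℕ; zero; suc; _∸_; _≤?_)
open import Data.Nat using (_!)
open import Data.Fin using (Fin; toℕ)
open import Relation.Nullary using (¬_; yes; no)
open import Relation.Nullary.Decidable using (⌊_⌋)
open import Data.Bool using (if_then_else_)

-- A field of characteristic 0, written out: a commutative ring with an
-- inverse operation that is a two-sided inverse on nonzero elements
-- (its value at 0 is irrelevant), 1 ≉ 0, and m·1 ≉ 0 for all m ≥ 1.
-- embedding of ℕ into a commutative ring: m ↦ 1 + 1 + ... + 1 (m times)
ιR : ∀ {c ℓ} (R : CommutativeRing c ℓ) → ℕ → CommutativeRing.Carrier R
ιR R zero = CommutativeRing.0# R
ιR R (suc m) = CommutativeRing._+_ R (CommutativeRing.1# R) (ιR R m)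

record Field0 (c ℓ : Level) : Set (lsuc (c ⊔ ℓ)) where
  field
    commutativeRing : CommutativeRing c ℓ
  open CommutativeRing commutativeRing
  field
    _⁻¹ : Carrier → Carrier
    ⁻¹-inverse : ∀ x → ¬ (x ≈ 0#) → x * (x ⁻¹) ≈ 1#
    char0 : ∀ m → ¬ (ιR commutativeRing (suc m) ≈ 0#)

module FieldDefs {c ℓ : Level} (F : Field0 c ℓ) where
  open Field0 F public
  open CommutativeRing commutativeRing public

  ι : ℕ → Carrier
  ι = ιR commutativeRing

  infixl 6 _−_
  _−_ : Carrier → Carrier → Carrier
  x − y = x + (- y)

  sumℕ : ℕ → (ℕ → Carrier) → Carrier
  sumℕ zero f = 0#
  sumℕ (suc m) f = sumℕ m f + f m

  sumFin : ∀ {m} → (Fin m → Carrier) → Carrier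
  sumFin {zero} f = 0#
  sumFin {suc m} f = f Fin.zero + sumFin (λ i → f (Fin.suc i))

  prodℕ : ℕ → (ℕ → Carrier) → Carrier
  prodℕ zero f = 1#
  prodℕ (suc k) f = prodℕ k f * f k

  Series : Set c
  Series = ℕ → Carrier

  _⊛_ : Series → Series → Series
  (f ⊛ g) ℓ' = sumℕ (suc ℓ') (λ i → f i * g (ℓ' ∸ i))

  oneS : Series
  oneS zero = 1#
  oneS (suc _) = 0#

  powS : Series → ℕ → Series
  powS f zero = oneS
  powS f (suc k) = powS f k ⊛ f

  binom : Carrier → ℕ → Carrier
  binom λ' k = prodℕ k (λ j → λ' − ι j) * (ι (k !) ⁻¹)

  -- φ(t) = 1 + s_1 t + ... + s_r t^r ; s (i) stands for s_{i+1}
  φ : ∀ {r} → (Fin r → Carrier) → Series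
  φ {r} s zero = 1#
  φ {r} s (suc k) with suc k ≤? r
  ... | yes p = s (Data.Fin.fromℕ< p)
  ... | no _ = 0#

  φ-1 : ∀ {r} → (Fin r → Carrier) → Series
  φ-1 s zero = 0#
  φ-1 s (suc k) = φ s (suc k)

  -- β_ℓ(λ) = [t^ℓ] φ(t)^λ = [t^ℓ] Σ_k binom(λ,k) (φ(t)-1)^k
  -- (only k ≤ ℓ contribute since φ-1 has zero constant term)
  β : ∀ {r} → (Fin r → Carrier) → ℕ → Carrier → Carrier
  β s ℓ' λ' = sumℕ (suc ℓ') (λ k → binom λ' k * powS (φ-1 s) k ℓ')

  Mat : ℕ → Set c
  Mat m = Fin m → Fin m → Carrier

  _·_ : ∀ {m} → Mat m → Mat m → Mat m
  (A · B) i j = sumFin (λ k → A i k * B k j)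

  _⊖_ : ∀ {m} → Mat m → Mat m → Mat m
  (A ⊖ B) i j = A i j − B i j

  scal : ∀ {m} → Carrier → Mat m → Mat m
  scal x A i j = x * A i j

  diag : ∀ {m} → (Fin m → Carrier) → Mat m
  diag d i j = if ⌊ toℕ i Data.Nat.≟ toℕ j ⌋ then d i else 0#

  idM : ∀ {m} → Mat m
  idM = diag (λ _ → 1#)

  lowerEntry : ∀ {m} → (ℕ → Carrier) → Fin m → Fin m → Carrier
  lowerEntry a i j = if ⌊ toℕ j ≤? toℕ i ⌋ then a (toℕ i ∸ toℕ j) else 0#

  Smat : ∀ m → Series → Mat m
  Smat m ψ i j = lowerEntry ψ i j

  Pmat : ∀ {r m} → (Fin r → Carrier) → (Fin m → Carrier) → Mat m
  Pmat s λs i j = lowerEntry (λ ℓ' → β s ℓ' (λs i)) i j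

  Qmat : ∀ {r m} → (Fin r → Carrier) → (Fin m → Carrier) → Mat m
  Qmat s μs i j = lowerEntry (λ ℓ' → β s ℓ' (μs j)) i j

  _≈M_ : ∀ {m} → Mat m → Mat m → Set ℓ
  A ≈M B = ∀ i j → A i j ≈ B i j

  -- The objects of the lemma (indices are 0-based: Fin r ∋ i stands
  -- for the paper's index i+1).
  module Lemma13Objects (r : ℕ) (s : Fin r → Carrier) (n : Carrier) where
    rφ-tφ' : Series
    rφ-tφ' k = ι r * φ s k − ι k * φ s k

    R₁ : Mat r
    R₁ = scal n (Smat r rφ-tφ') ⊖ (Smat r (φ s) · diag (λ j → ι (r ∸ suc (toℕ j))))

    ζden : Fin r → Carrier
    ζden i = ι r * n − ι (r ∸ suc (toℕ i))

    ζ : Fin r → Carrier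
    ζ i = n * (ζden i ⁻¹)

    μs : Fin r → Carrier
    μs j = ι (r ∸ suc (toℕ j)) * (ι r ⁻¹)

    λs : Fin r → Carrier
    λs i = - (ι ((r Data.Nat.+ r) ∸ suc (toℕ i)) * (ι r ⁻¹))

    RHS : Mat r
    RHS = scal (n ⁻¹) ((Qmat s μs · diag ζ) · Pmat s λs)

{-# OPTIONS --safe #-}
module Submission where

-- Write φ^a for Σ_k binom(a,k) (φ − 1)^k, the series whose coefficients are the β_ℓ(a).
-- Comparing partial sums shows φ · t(φ^a)′ = a · tφ′ · φ^a; in characteristic 0 this ODE has a
-- unique solution with constant term 1, hence φ^a φ^b = φ^(a+b). For ρ = rφ − tφ′ one has
-- φ^a ρ = r φ^(a+1) − t(φ^(a+1))′/(a+1), whose t^L coefficient is r for L = 0 and vanishes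
-- when (a+1) r = L ≥ 1.
--
-- Let M be the lower triangular matrix with M_ij = [t^(i−j)] φ^(μ_j) ρ / r. Because
-- λ_i + μ_j + 1 = (i − j)/r, the above gives P M = 1. Because r − 1 − k = r μ_j − (k − j) and
-- ζ_j (n − μ_j) = n/r, the ODE for φ^(μ_j) gives R₁ Q diag(ζ) = n M. So R₁ · RHS = M P = 1,
-- and one-sided inverses of lower triangular matrices are two-sided.

open import Defs
open import Level using (Level)
open import Algebra.Bundles using (CommutativeRing)
import Algebra.Solver.Ring.AlmostCommutativeRing as ACR
open import Data.Bool using (if_then_else_)
open import Data.Fin as Fin using (Fin; toℕ)
import Data.Fin.Properties as FinP
open import Data.Integer as ℤ using (ℤ; +_; -[1+_])
import Data.Integer.Properties as ℤP
open import Data.Maybe using (Maybe; just; nothing)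
open import Data.Nat as ℕ using (ℕ; zero; suc; _∸_; _≤_; _<_; s≤s; z≤n; _≤?_; _<?_)
import Data.Nat.Properties as ℕP
open import Data.Product using (_,_; _×_)
import Data.Sign as Sign
open import Data.Sum using (inj₁; inj₂)
open import Relation.Nullary using (¬_; yes; no; contradiction)
open import Relation.Nullary.Decidable using (⌊_⌋; ⌊⌋-map′)
import Relation.Binary.PropositionalEquality as Eq
open Eq using (_≡_; _≢_)

-- Integer coefficients, so that the solver compares normal forms by computation.
module IntegerRingSolver {c ℓ} (R : CommutativeRing c ℓ) where
  open CommutativeRing R
  open import Algebra.Properties.Ring ring using (-‿distribˡ-*; -‿distribʳ-*; -‿involutive; -0#≈0#; -‿+-comm)
  open import Relation.Binary.Reasoning.Setoid setoid

  private
    ι : ℕ → Carrier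
    ι = ιR R

  ι-+ : ∀ a b → ι (a ℕ.+ b) ≈ ι a + ι b
  ι-+ zero b = sym (+-identityˡ _)
  ι-+ (suc a) b = trans (+-congˡ (ι-+ a b)) (sym (+-assoc _ _ _))

  ι-* : ∀ a b → ι (a ℕ.* b) ≈ ι a * ι b
  ι-* zero b = sym (zeroˡ _)
  ι-* (suc a) b = begin
    ι (b ℕ.+ a ℕ.* b)      ≈⟨ ι-+ b (a ℕ.* b) ⟩
    ι b + ι (a ℕ.* b)      ≈⟨ +-cong (sym (*-identityˡ _)) (ι-* a b) ⟩
    1# * ι b + ι a * ι b   ≈⟨ sym (distribʳ _ _ _) ⟩
    (1# + ι a) * ι b       ∎

  private
    ⟦_⟧ℤ : ℤ → Carrier
    ⟦ + n ⟧ℤ = ι n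
    ⟦ -[1+ n ] ⟧ℤ = - ι (suc n)

    x−0≈x : ∀ x → x + - 0# ≈ x
    x−0≈x x = trans (+-congˡ -0#≈0#) (+-identityʳ x)

    1+x−[1+y]≈x−y : ∀ x y → (1# + x) + - (1# + y) ≈ x + - y
    1+x−[1+y]≈x−y x y = begin
      (1# + x) + - (1# + y)    ≈⟨ +-cong (+-comm _ _) (sym (-‿+-comm _ _)) ⟩
      (x + 1#) + (- 1# + - y)  ≈⟨ +-assoc _ _ _ ⟩
      x + (1# + (- 1# + - y))  ≈⟨ +-congˡ (sym (+-assoc _ _ _)) ⟩
      x + ((1# + - 1#) + - y)  ≈⟨ +-congˡ (+-congʳ (-‿inverseʳ _)) ⟩
      x + (0# + - y)           ≈⟨ +-congˡ (+-identityˡ _) ⟩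
      x + - y                  ∎

    ⊖-homo : ∀ m n → ⟦ m ℤ.⊖ n ⟧ℤ ≈ ι m + - ι n
    ⊖-homo zero zero = sym (x−0≈x 0#)
    ⊖-homo zero (suc n) = sym (+-identityˡ _)
    ⊖-homo (suc m) zero = sym (x−0≈x _)
    ⊖-homo (suc m) (suc n) = begin
      ⟦ suc m ℤ.⊖ suc n ⟧ℤ   ≈⟨ reflexive (Eq.cong ⟦_⟧ℤ (ℤP.[1+m]⊖[1+n]≡m⊖n m n)) ⟩
      ⟦ m ℤ.⊖ n ⟧ℤ           ≈⟨ ⊖-homo m n ⟩
      ι m + - ι n           ≈⟨ sym (1+x−[1+y]≈x−y _ _) ⟩
      ι (suc m) + - ι (suc n) ∎

    -◃-homo : ∀ n → ⟦ Sign.- ℤ.◃ n ⟧ℤ ≈ - ι n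
    -◃-homo zero = sym -0#≈0#
    -◃-homo (suc n) = refl

    +◃-homo : ∀ n → ⟦ Sign.+ ℤ.◃ n ⟧ℤ ≈ ι n
    +◃-homo zero = refl
    +◃-homo (suc n) = refl

    +-homo : ∀ i j → ⟦ i ℤ.+ j ⟧ℤ ≈ ⟦ i ⟧ℤ + ⟦ j ⟧ℤ
    +-homo (+ m) (+ n) = ι-+ m n
    +-homo (+ m) -[1+ n ] = ⊖-homo m (suc n)
    +-homo -[1+ m ] (+ n) = trans (⊖-homo n (suc m)) (+-comm _ _)
    +-homo -[1+ m ] -[1+ n ] = begin
      - ι (suc (suc (m ℕ.+ n)))     ≈⟨ -‿cong (reflexive (Eq.cong (λ k → ι (suc k)) (Eq.sym (ℕP.+-suc m n)))) ⟩
      - ι (suc m ℕ.+ suc n)         ≈⟨ -‿cong (ι-+ (suc m) (suc n)) ⟩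
      - (ι (suc m) + ι (suc n))     ≈⟨ sym (-‿+-comm _ _) ⟩
      - ι (suc m) + - ι (suc n)     ∎

    *-homo : ∀ i j → ⟦ i ℤ.* j ⟧ℤ ≈ ⟦ i ⟧ℤ * ⟦ j ⟧ℤ
    *-homo (+ m) (+ n) = trans (+◃-homo (m ℕ.* n)) (ι-* m n)
    *-homo (+ m) -[1+ n ] = trans (-◃-homo (m ℕ.* suc n)) (trans (-‿cong (ι-* m (suc n))) (-‿distribʳ-* _ _))
    *-homo -[1+ m ] (+ n) = trans (-◃-homo (suc m ℕ.* n)) (trans (-‿cong (ι-* (suc m) n)) (-‿distribˡ-* _ _))
    *-homo -[1+ m ] -[1+ n ] = begin
      ⟦ + (suc m ℕ.* suc n) ⟧ℤ       ≈⟨ ι-* (suc m) (suc n) ⟩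
      ι (suc m) * ι (suc n)         ≈⟨ sym (-‿involutive _) ⟩
      - - (ι (suc m) * ι (suc n))   ≈⟨ -‿cong (-‿distribʳ-* _ _) ⟩
      - (ι (suc m) * - ι (suc n))   ≈⟨ -‿distribˡ-* _ _ ⟩
      - ι (suc m) * - ι (suc n)     ∎

    -‿homo : ∀ i → ⟦ ℤ.- i ⟧ℤ ≈ - ⟦ i ⟧ℤ
    -‿homo (+ zero) = sym -0#≈0#
    -‿homo (+ suc n) = refl
    -‿homo -[1+ n ] = sym (-‿involutive _)

    ⟦⟧-homomorphism : ℤ.+-*-rawRing ACR.-Raw-AlmostCommutative⟶ ACR.fromCommutativeRing R
    ⟦⟧-homomorphism = record
      { ⟦_⟧ = ⟦_⟧ℤ ; +-homo = +-homo ; *-homo = *-homo ; -‿homo = -‿homo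
      ; 0-homo = refl ; 1-homo = +-identityʳ 1# }

    ⟦⟧-≟ : ∀ a b → Maybe (⟦ a ⟧ℤ ≈ ⟦ b ⟧ℤ)
    ⟦⟧-≟ a b with a ℤ.≟ b
    ... | yes Eq.refl = just refl
    ... | no _ = nothing

  open import Algebra.Solver.Ring ℤ.+-*-rawRing (ACR.fromCommutativeRing R) ⟦⟧-homomorphism ⟦⟧-≟ public

module Development {c ℓ : Level} (F : Field0 c ℓ) where
  open FieldDefs F
  open IntegerRingSolver commutativeRing
  open import Algebra.Properties.Ring ring using (-‿distribˡ-*; -‿distribʳ-*; -0#≈0#; -‿+-comm)
  open import Relation.Binary.Reasoning.Setoid setoid

  ι-∸ : ∀ a b → b ≤ a → ι (a ∸ b) ≈ ι a − ι b
  ι-∸ a b b≤a = begin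
    ι (a ∸ b)                ≈⟨ solve 2 (λ y z → y := (y :+ z) :- z) refl (ι (a ∸ b)) (ι b) ⟩
    (ι (a ∸ b) + ι b) − ι b  ≈⟨ +-congʳ (trans (sym (ι-+ (a ∸ b) b)) (reflexive (Eq.cong ι (ℕP.m∸n+n≡m b≤a)))) ⟩
    ι a − ι b                ∎

  ι1≈1 : ι 1 ≈ 1#
  ι1≈1 = +-identityʳ 1#

  ⁻¹-inverseˡ : ∀ x → ¬ (x ≈ 0#) → x ⁻¹ * x ≈ 1#
  ⁻¹-inverseˡ x x≉0 = trans (*-comm _ _) (⁻¹-inverse x x≉0)

  *-cancelˡ : ∀ x {a b} → ¬ (x ≈ 0#) → x * a ≈ x * b → a ≈ b
  *-cancelˡ x {a} {b} x≉0 xa≈xb = begin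
    a                ≈⟨ sym (*-identityˡ _) ⟩
    1# * a           ≈⟨ *-congʳ (sym (⁻¹-inverseˡ x x≉0)) ⟩
    (x ⁻¹ * x) * a   ≈⟨ *-assoc _ _ _ ⟩
    x ⁻¹ * (x * a)   ≈⟨ *-congˡ xa≈xb ⟩
    x ⁻¹ * (x * b)   ≈⟨ sym (*-assoc _ _ _) ⟩
    (x ⁻¹ * x) * b   ≈⟨ *-congʳ (⁻¹-inverseˡ x x≉0) ⟩
    1# * b           ≈⟨ *-identityˡ _ ⟩
    b                ∎

  *-≉0 : ∀ {x y} → ¬ (x ≈ 0#) → ¬ (y ≈ 0#) → ¬ (x * y ≈ 0#)
  *-≉0 {x} {y} x≉0 y≉0 xy≈0 = y≉0 (*-cancelˡ x x≉0 (trans xy≈0 (sym (zeroʳ x))))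

  ⁻¹-cong : ∀ {x y} → ¬ (x ≈ 0#) → x ≈ y → x ⁻¹ ≈ y ⁻¹
  ⁻¹-cong {x} {y} x≉0 x≈y = *-cancelˡ x x≉0 (begin
    x * x ⁻¹   ≈⟨ ⁻¹-inverse x x≉0 ⟩
    1#         ≈⟨ sym (⁻¹-inverse y (λ y≈0 → x≉0 (trans x≈y y≈0))) ⟩
    y * y ⁻¹   ≈⟨ *-congʳ (sym x≈y) ⟩
    x * y ⁻¹   ∎)

  ⁻¹-distrib-* : ∀ {x y} → ¬ (x ≈ 0#) → ¬ (y ≈ 0#) → (x * y) ⁻¹ ≈ x ⁻¹ * y ⁻¹
  ⁻¹-distrib-* {x} {y} x≉0 y≉0 = *-cancelˡ (x * y) xy≉0 (begin
    (x * y) * (x * y) ⁻¹      ≈⟨ ⁻¹-inverse _ xy≉0 ⟩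
    1#                        ≈⟨ sym (*-identityˡ _) ⟩
    1# * 1#                   ≈⟨ sym (*-cong (⁻¹-inverse x x≉0) (⁻¹-inverse y y≉0)) ⟩
    (x * x ⁻¹) * (y * y ⁻¹)   ≈⟨ solve 4 (λ a b c d → (a :* c) :* (b :* d) := (a :* b) :* (c :* d)) refl _ _ _ _ ⟩
    (x * y) * (x ⁻¹ * y ⁻¹)   ∎)
    where
    xy≉0 : ¬ (x * y ≈ 0#)
    xy≉0 = *-≉0 x≉0 y≉0

  ι-!≉0 : ∀ k → ¬ (ι (k ℕ.!) ≈ 0#)
  ι-!≉0 k with k ℕ.! | ℕP.1≤n! k
  ... | suc m | _ = char0 m

  binom-zero : ∀ x → binom x 0 ≈ 1#
  binom-zero x = begin
    1# * ι 1 ⁻¹     ≈⟨ *-congʳ (sym ι1≈1) ⟩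
    ι 1 * ι 1 ⁻¹    ≈⟨ ⁻¹-inverse _ (char0 0) ⟩
    1#              ∎

  binom-suc : ∀ x k → binom x (suc k) * ι (suc k) ≈ (x − ι k) * binom x k
  binom-suc x k = begin
    (p * (x − ι k)) * ι (suc k ℕ.!) ⁻¹ * A
      ≈⟨ *-congʳ (*-congˡ [1+k]!⁻¹≈A⁻¹B⁻¹) ⟩
    (p * (x − ι k)) * (A ⁻¹ * B ⁻¹) * A
      ≈⟨ solve 5 (λ p′ xk a ai bi → (p′ :* xk) :* (ai :* bi) :* a := (xk :* (p′ :* bi)) :* (a :* ai)) refl _ _ _ _ _ ⟩
    ((x − ι k) * (p * B ⁻¹)) * (A * A ⁻¹)
      ≈⟨ *-congˡ (⁻¹-inverse A (char0 k)) ⟩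
    ((x − ι k) * binom x k) * 1#
      ≈⟨ *-identityʳ _ ⟩
    (x − ι k) * binom x k ∎
    where
    p A B : Carrier
    p = prodℕ k (λ j → x − ι j)
    A = ι (suc k)
    B = ι (k ℕ.!)
    [1+k]!⁻¹≈A⁻¹B⁻¹ : ι (suc k ℕ.!) ⁻¹ ≈ A ⁻¹ * B ⁻¹
    [1+k]!⁻¹≈A⁻¹B⁻¹ = trans (⁻¹-cong (ι-!≉0 (suc k)) (ι-* (suc k) (k ℕ.!))) (⁻¹-distrib-* (char0 k) (ι-!≉0 k))

  -- Finite sums

  sumℕ-cong : ∀ m {f g : ℕ → Carrier} → (∀ i → i < m → f i ≈ g i) → sumℕ m f ≈ sumℕ m g
  sumℕ-cong zero f≈g = refl
  sumℕ-cong (suc m) f≈g = +-cong (sumℕ-cong m (λ i i<m → f≈g i (ℕP.m<n⇒m<1+n i<m))) (f≈g m ℕP.≤-refl)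

  sumℕ-zero : ∀ m {f : ℕ → Carrier} → (∀ i → i < m → f i ≈ 0#) → sumℕ m f ≈ 0#
  sumℕ-zero zero f≈0 = refl
  sumℕ-zero (suc m) f≈0 =
    trans (+-cong (sumℕ-zero m (λ i i<m → f≈0 i (ℕP.m<n⇒m<1+n i<m))) (f≈0 m ℕP.≤-refl)) (+-identityˡ _)

  sumℕ-+ : ∀ m (f g : ℕ → Carrier) → sumℕ m (λ i → f i + g i) ≈ sumℕ m f + sumℕ m g
  sumℕ-+ zero f g = sym (+-identityˡ _)
  sumℕ-+ (suc m) f g = trans (+-congʳ (sumℕ-+ m f g))
    (solve 4 (λ a b x y → (a :+ b) :+ (x :+ y) := (a :+ x) :+ (b :+ y)) refl _ _ _ _)

  sumℕ-*ˡ : ∀ m x (f : ℕ → Carrier) → sumℕ m (λ i → x * f i) ≈ x * sumℕ m f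
  sumℕ-*ˡ zero x f = sym (zeroʳ _)
  sumℕ-*ˡ (suc m) x f = trans (+-congʳ (sumℕ-*ˡ m x f)) (sym (distribˡ _ _ _))

  sumℕ-*ʳ : ∀ m x (f : ℕ → Carrier) → sumℕ m (λ i → f i * x) ≈ sumℕ m f * x
  sumℕ-*ʳ m x f = trans (sumℕ-cong m (λ i _ → *-comm _ _)) (trans (sumℕ-*ˡ m x f) (*-comm _ _))

  sumℕ-− : ∀ m (f g : ℕ → Carrier) → sumℕ m (λ i → f i − g i) ≈ sumℕ m f − sumℕ m g
  sumℕ-− m f g = trans (sumℕ-+ m f (λ i → - g i)) (+-congˡ (-sum m))
    where
    -sum : ∀ m → sumℕ m (λ i → - g i) ≈ - sumℕ m g
    -sum zero = sym -0#≈0#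
    -sum (suc m) = trans (+-congʳ (-sum m)) (-‿+-comm _ _)

  sumℕ-suc : ∀ m (f : ℕ → Carrier) → sumℕ (suc m) f ≈ f 0 + sumℕ m (λ i → f (suc i))
  sumℕ-suc zero f = +-comm _ _
  sumℕ-suc (suc m) f = trans (+-congʳ (sumℕ-suc m f)) (+-assoc _ _ _)

  sumℕ-split : ∀ a b (f : ℕ → Carrier) → sumℕ (a ℕ.+ b) f ≈ sumℕ a f + sumℕ b (λ i → f (a ℕ.+ i))
  sumℕ-split a zero f = trans (reflexive (Eq.cong (λ k → sumℕ k f) (ℕP.+-identityʳ a))) (sym (+-identityʳ _))
  sumℕ-split a (suc b) f = begin
    sumℕ (a ℕ.+ suc b) f                                     ≈⟨ reflexive (Eq.cong (λ k → sumℕ k f) (ℕP.+-suc a b)) ⟩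
    sumℕ (a ℕ.+ b) f + f (a ℕ.+ b)                           ≈⟨ +-congʳ (sumℕ-split a b f) ⟩
    (sumℕ a f + sumℕ b (λ i → f (a ℕ.+ i))) + f (a ℕ.+ b)    ≈⟨ +-assoc _ _ _ ⟩
    sumℕ a f + sumℕ (suc b) (λ i → f (a ℕ.+ i))              ∎

  sumℕ-reverse : ∀ m (f : ℕ → Carrier) → sumℕ m f ≈ sumℕ m (λ i → f (m ∸ suc i))
  sumℕ-reverse zero f = refl
  sumℕ-reverse (suc m) f = begin
    sumℕ m f + f m                                ≈⟨ +-comm _ _ ⟩
    f m + sumℕ m f                                ≈⟨ +-congˡ (sumℕ-reverse m f) ⟩
    f m + sumℕ m (λ i → f (m ∸ suc i))            ≈⟨ sym (sumℕ-suc m (λ i → f (suc m ∸ suc i))) ⟩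
    sumℕ (suc m) (λ i → f (suc m ∸ suc i))        ∎

  sumℕ-triangle : ∀ N (G : ℕ → ℕ → Carrier) →
    sumℕ N (λ i → sumℕ (suc i) (λ j → G j (i ∸ j))) ≈ sumℕ N (λ j → sumℕ (N ∸ j) (G j))
  sumℕ-triangle zero G = refl
  sumℕ-triangle (suc N) G = begin
    sumℕ N (λ i → sumℕ (suc i) (λ j → G j (i ∸ j))) + (sumℕ N (λ j → G j (N ∸ j)) + G N (N ∸ N))
      ≈⟨ +-congʳ (sumℕ-triangle N G) ⟩
    sumℕ N (λ j → sumℕ (N ∸ j) (G j)) + (sumℕ N (λ j → G j (N ∸ j)) + G N (N ∸ N))
      ≈⟨ sym (+-assoc _ _ _) ⟩
    (sumℕ N (λ j → sumℕ (N ∸ j) (G j)) + sumℕ N (λ j → G j (N ∸ j))) + G N (N ∸ N)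
      ≈⟨ +-cong (sym (sumℕ-+ N _ _)) (trans (sym (+-identityˡ _)) (reflexive (Eq.cong (λ k → 0# + G N k) (ℕP.n∸n≡0 N)))) ⟩
    sumℕ N (λ j → sumℕ (N ∸ j) (G j) + G j (N ∸ j)) + sumℕ 1 (G N)
      ≈⟨ +-cong (sumℕ-cong N (λ j j<N → reflexive (Eq.cong (λ k → sumℕ k (G j)) (Eq.sym (ℕP.+-∸-assoc 1 (ℕP.<⇒≤ j<N))))))
                (reflexive (Eq.cong (λ k → sumℕ k (G N)) (Eq.sym (Eq.trans (ℕP.+-∸-assoc 1 (ℕP.≤-refl {N})) (Eq.cong suc (ℕP.n∸n≡0 N)))))) ⟩
    sumℕ N (λ j → sumℕ (suc N ∸ j) (G j)) + sumℕ (suc N ∸ N) (G N) ∎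

  -- Formal power series

  infix 4 _≈S_
  _≈S_ : Series → Series → Set ℓ
  f ≈S g = ∀ k → f k ≈ g k

  infixl 6 _⊕_ _⊝_
  infixr 7 _•_

  _⊕_ : Series → Series → Series
  (f ⊕ g) k = f k + g k

  _⊝_ : Series → Series → Series
  (f ⊝ g) k = f k − g k

  _•_ : Carrier → Series → Series
  (a • f) k = a * f k

  D : Series → Series
  D f k = ι k * f k

  ⊛-cong-upTo : ∀ L {f f′ g g′ : Series} → (∀ i → i ≤ L → f i ≈ f′ i) → (∀ i → i ≤ L → g i ≈ g′ i) →
                (f ⊛ g) L ≈ (f′ ⊛ g′) L
  ⊛-cong-upTo L f≈f′ g≈g′ =
    sumℕ-cong (suc L) (λ i i≤L → *-cong (f≈f′ i (ℕP.≤-pred i≤L)) (g≈g′ (L ∸ i) (ℕP.m∸n≤m L i)))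

  ⊛-congˡ : ∀ {f f′} g → f ≈S f′ → f ⊛ g ≈S f′ ⊛ g
  ⊛-congˡ g f≈f′ L = ⊛-cong-upTo L {g = g} (λ i _ → f≈f′ i) (λ _ _ → refl)

  ⊛-congʳ : ∀ f {g g′} → g ≈S g′ → f ⊛ g ≈S f ⊛ g′
  ⊛-congʳ f g≈g′ L = ⊛-cong-upTo L {f = f} (λ _ _ → refl) (λ i _ → g≈g′ i)

  ⊛-comm : ∀ f g → f ⊛ g ≈S g ⊛ f
  ⊛-comm f g L = begin
    sumℕ (suc L) (λ i → f i * g (L ∸ i))                ≈⟨ sumℕ-reverse (suc L) _ ⟩
    sumℕ (suc L) (λ i → f (L ∸ i) * g (L ∸ (L ∸ i)))    ≈⟨ sumℕ-cong (suc L) (λ i i≤L →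
      trans (*-comm _ _) (*-congʳ (reflexive (Eq.cong g (ℕP.m∸[m∸n]≡n (ℕP.≤-pred i≤L)))))) ⟩
    sumℕ (suc L) (λ i → g i * f (L ∸ i))                ∎

  ⊛-assoc : ∀ f g h → (f ⊛ g) ⊛ h ≈S f ⊛ (g ⊛ h)
  ⊛-assoc f g h L = begin
    sumℕ (suc L) (λ i → sumℕ (suc i) (λ j → f j * g (i ∸ j)) * h (L ∸ i))
      ≈⟨ sumℕ-cong (suc L) (λ i _ → sym (sumℕ-*ʳ (suc i) _ _)) ⟩
    sumℕ (suc L) (λ i → sumℕ (suc i) (λ j → (f j * g (i ∸ j)) * h (L ∸ i)))
      ≈⟨ sumℕ-cong (suc L) (λ i _ → sumℕ-cong (suc i) (λ j j≤i → trans (*-assoc _ _ _)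
           (*-congˡ (*-congˡ (reflexive (Eq.cong h (L∸i≡L∸j∸[i∸j] (ℕP.≤-pred j≤i)))))))) ⟩
    sumℕ (suc L) (λ i → sumℕ (suc i) (λ j → G j (i ∸ j)))
      ≈⟨ sumℕ-triangle (suc L) G ⟩
    sumℕ (suc L) (λ j → sumℕ (suc L ∸ j) (G j))
      ≈⟨ sumℕ-cong (suc L) (λ j j≤L → trans (reflexive (Eq.cong (λ t → sumℕ t (G j)) (ℕP.+-∸-assoc 1 (ℕP.≤-pred j≤L))))
                                             (sumℕ-*ˡ (suc (L ∸ j)) (f j) _)) ⟩
    sumℕ (suc L) (λ j → f j * (g ⊛ h) (L ∸ j)) ∎
    where
    G : ℕ → ℕ → Carrier
    G j k = f j * (g k * h (L ∸ j ∸ k))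
    L∸i≡L∸j∸[i∸j] : ∀ {i j} → j ≤ i → L ∸ i ≡ L ∸ j ∸ (i ∸ j)
    L∸i≡L∸j∸[i∸j] {i} {j} j≤i = Eq.sym (Eq.trans (ℕP.∸-+-assoc L j (i ∸ j)) (Eq.cong (L ∸_) (ℕP.m+[n∸m]≡n j≤i)))

  ⊛-swapʳ : ∀ f g h → (f ⊛ g) ⊛ h ≈S (f ⊛ h) ⊛ g
  ⊛-swapʳ f g h L = begin
    ((f ⊛ g) ⊛ h) L   ≈⟨ ⊛-assoc f g h L ⟩
    (f ⊛ (g ⊛ h)) L   ≈⟨ ⊛-congʳ f (⊛-comm g h) L ⟩
    (f ⊛ (h ⊛ g)) L   ≈⟨ sym (⊛-assoc f h g L) ⟩
    ((f ⊛ h) ⊛ g) L   ∎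

  ⊛-distribˡ-⊕ : ∀ f g h → f ⊛ (g ⊕ h) ≈S (f ⊛ g) ⊕ (f ⊛ h)
  ⊛-distribˡ-⊕ f g h L = trans (sumℕ-cong (suc L) (λ _ _ → distribˡ _ _ _)) (sumℕ-+ (suc L) _ _)

  ⊛-distribʳ-⊕ : ∀ f g h → (g ⊕ h) ⊛ f ≈S (g ⊛ f) ⊕ (h ⊛ f)
  ⊛-distribʳ-⊕ f g h L = trans (sumℕ-cong (suc L) (λ _ _ → distribʳ _ _ _)) (sumℕ-+ (suc L) _ _)

  ⊛-distribˡ-⊝ : ∀ f g h → f ⊛ (g ⊝ h) ≈S (f ⊛ g) ⊝ (f ⊛ h)
  ⊛-distribˡ-⊝ f g h L =
    trans (sumℕ-cong (suc L) (λ _ _ → trans (distribˡ _ _ _) (+-congˡ (sym (-‿distribʳ-* _ _))))) (sumℕ-− (suc L) _ _)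

  ⊛-•ʳ : ∀ f a g → f ⊛ (a • g) ≈S a • (f ⊛ g)
  ⊛-•ʳ f a g L =
    trans (sumℕ-cong (suc L) (λ _ _ → solve 3 (λ x y z → x :* (y :* z) := y :* (x :* z)) refl _ _ _)) (sumℕ-*ˡ (suc L) _ _)

  ⊛-•ˡ : ∀ f a g → (a • g) ⊛ f ≈S a • (g ⊛ f)
  ⊛-•ˡ f a g L = trans (sumℕ-cong (suc L) (λ _ _ → *-assoc _ _ _)) (sumℕ-*ˡ (suc L) _ _)

  ⊛-identityˡ : ∀ f → oneS ⊛ f ≈S f
  ⊛-identityˡ f L = begin
    sumℕ (suc L) (λ i → oneS i * f (L ∸ i))              ≈⟨ sumℕ-suc L _ ⟩
    1# * f L + sumℕ L (λ i → 0# * f (L ∸ suc i))         ≈⟨ +-cong (*-identityˡ _) (sumℕ-zero L (λ _ _ → zeroˡ _)) ⟩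
    f L + 0#                                              ≈⟨ +-identityʳ _ ⟩
    f L                                                   ∎

  D-Leibniz : ∀ f g → D (f ⊛ g) ≈S (D f ⊛ g) ⊕ (f ⊛ D g)
  D-Leibniz f g L = begin
    ι L * sumℕ (suc L) (λ i → f i * g (L ∸ i))          ≈⟨ sym (sumℕ-*ˡ (suc L) _ _) ⟩
    sumℕ (suc L) (λ i → ι L * (f i * g (L ∸ i)))        ≈⟨ sumℕ-cong (suc L) (λ i i≤L → begin
        ι L * (f i * g (L ∸ i))
          ≈⟨ *-congʳ (trans (reflexive (Eq.cong ι (Eq.sym (ℕP.m+[n∸m]≡n (ℕP.≤-pred i≤L))))) (ι-+ i (L ∸ i))) ⟩
        (ι i + ι (L ∸ i)) * (f i * g (L ∸ i))
          ≈⟨ solve 4 (λ a b x y → (a :+ b) :* (x :* y) := (a :* x) :* y :+ x :* (b :* y)) refl _ _ _ _ ⟩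
        (ι i * f i) * g (L ∸ i) + f i * (ι (L ∸ i) * g (L ∸ i)) ∎) ⟩
    sumℕ (suc L) (λ i → (ι i * f i) * g (L ∸ i) + f i * (ι (L ∸ i) * g (L ∸ i)))
                                                         ≈⟨ sumℕ-+ (suc L) _ _ ⟩
    (D f ⊛ g) L + (f ⊛ D g) L                            ∎

  D-cong : ∀ {f g} → f ≈S g → D f ≈S D g
  D-cong f≈g k = *-congˡ (f≈g k)

  VanishesBelow : ℕ → Series → Set ℓ
  VanishesBelow k f = ∀ i → i < k → f i ≈ 0#

  ⊛-vanishesBelow : ∀ {a b f g} → VanishesBelow a f → VanishesBelow b g → VanishesBelow (a ℕ.+ b) (f ⊛ g)
  ⊛-vanishesBelow {a} {b} {f} {g} f≈0 g≈0 L L<a+b = sumℕ-zero (suc L) term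
    where
    term : ∀ i → i < suc L → f i * g (L ∸ i) ≈ 0#
    term i i≤L with i <? a
    ... | yes i<a = trans (*-congʳ (f≈0 i i<a)) (zeroˡ _)
    ... | no i≮a = trans (*-congˡ (g≈0 (L ∸ i) L∸i<b)) (zeroʳ _)
      where
      a≤i : a ≤ i
      a≤i = ℕP.≮⇒≥ i≮a
      L∸i<b : L ∸ i < b
      L∸i<b = ℕP.≤-<-trans (ℕP.∸-monoʳ-≤ L a≤i)
                (Eq.subst (L ∸ a <_) (ℕP.m+n∸m≡n a b) (ℕP.∸-monoˡ-< L<a+b (ℕP.≤-trans a≤i (ℕP.≤-pred i≤L))))

  D-vanishesBelow-1 : ∀ f → VanishesBelow 1 (D f)
  D-vanishesBelow-1 f zero _ = zeroˡ _
  D-vanishesBelow-1 f (suc i) (s≤s ())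

  powS-vanishesBelow : ∀ {f} → VanishesBelow 1 f → ∀ k → VanishesBelow k (powS f k)
  powS-vanishesBelow f≈0 zero i ()
  powS-vanishesBelow {f} f≈0 (suc k) =
    Eq.subst (λ m → VanishesBelow m (powS f (suc k))) (ℕP.+-comm k 1) (⊛-vanishesBelow (powS-vanishesBelow f≈0 k) f≈0)

  D-powS : ∀ f k → D (powS f (suc k)) ≈S ι (suc k) • (powS f k ⊛ D f)
  D-powS f zero L = begin
    ι L * (oneS ⊛ f) L     ≈⟨ D-cong (⊛-identityˡ f) L ⟩
    D f L                  ≈⟨ sym (⊛-identityˡ (D f) L) ⟩
    (oneS ⊛ D f) L         ≈⟨ sym (trans (*-congʳ ι1≈1) (*-identityˡ _)) ⟩
    ι 1 * (oneS ⊛ D f) L   ∎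
  D-powS f (suc k) L = begin
    D (fᵏ⁺¹ ⊛ f) L                                       ≈⟨ D-Leibniz fᵏ⁺¹ f L ⟩
    (D fᵏ⁺¹ ⊛ f) L + Y                                   ≈⟨ +-congʳ (⊛-congˡ f (D-powS f k) L) ⟩
    ((ι (suc k) • (powS f k ⊛ D f)) ⊛ f) L + Y           ≈⟨ +-congʳ (⊛-•ˡ f (ι (suc k)) _ L) ⟩
    ι (suc k) * ((powS f k ⊛ D f) ⊛ f) L + Y             ≈⟨ +-congʳ (*-congˡ (⊛-swapʳ (powS f k) (D f) f L)) ⟩
    ι (suc k) * Y + Y                                    ≈⟨ +-congˡ (sym (*-identityˡ Y)) ⟩
    ι (suc k) * Y + 1# * Y                               ≈⟨ trans (sym (distribʳ _ _ _)) (*-congʳ (+-comm _ _)) ⟩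
    ι (suc (suc k)) * Y                                  ∎
    where
    fᵏ⁺¹ : Series
    fᵏ⁺¹ = powS f (suc k)
    Y : Carrier
    Y = (fᵏ⁺¹ ⊛ D f) L

  -- Powers of φ with exponents in the field

  module Powers {r : ℕ} (s : Fin r → Carrier) where
    x : Series
    x = φ-1 s

    infix 25 φ^_
    φ^_ : Carrier → Series
    (φ^ a) L = β s L a

    x-vanishesBelow-1 : VanishesBelow 1 x
    x-vanishesBelow-1 zero _ = refl
    x-vanishesBelow-1 (suc i) (s≤s ())

    φ≈1+x : φ s ≈S oneS ⊕ x
    φ≈1+x zero = sym (+-identityʳ _)
    φ≈1+x (suc k) = sym (+-identityˡ _)

    D-x≈D-φ : D x ≈S D (φ s)
    D-x≈D-φ zero = trans (zeroˡ _) (sym (zeroˡ _))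
    D-x≈D-φ (suc k) = refl

    partialSum : Carrier → ℕ → Series
    partialSum a N L = sumℕ N (λ k → binom a k * powS x k L)

    partialSum-stable : ∀ a d N i → i < N → partialSum a (N ℕ.+ d) i ≈ partialSum a N i
    partialSum-stable a zero N i i<N = reflexive (Eq.cong (λ t → partialSum a t i) (ℕP.+-identityʳ N))
    partialSum-stable a (suc d) N i i<N = begin
      partialSum a (N ℕ.+ suc d) i
        ≈⟨ reflexive (Eq.cong (λ t → partialSum a t i) (ℕP.+-suc N d)) ⟩
      partialSum a (N ℕ.+ d) i + binom a (N ℕ.+ d) * powS x (N ℕ.+ d) i
        ≈⟨ +-cong (partialSum-stable a d N i i<N)
                  (trans (*-congˡ (powS-vanishesBelow x-vanishesBelow-1 (N ℕ.+ d) i (ℕP.<-≤-trans i<N (ℕP.m≤m+n N d)))) (zeroʳ _)) ⟩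
      partialSum a N i + 0#
        ≈⟨ +-identityʳ _ ⟩
      partialSum a N i ∎

    φ^≈partialSum : ∀ a L i → i ≤ L → (φ^ a) i ≈ partialSum a (suc L) i
    φ^≈partialSum a L i i≤L = sym (begin
      partialSum a (suc L) i                  ≈⟨ reflexive (Eq.cong (λ t → partialSum a (suc t) i) (Eq.sym (ℕP.m+[n∸m]≡n i≤L))) ⟩
      partialSum a (suc i ℕ.+ (L ∸ i)) i      ≈⟨ partialSum-stable a (L ∸ i) (suc i) i ℕP.≤-refl ⟩
      partialSum a (suc i) i                  ∎)

    partialSum-1 : ∀ a → partialSum a 1 ≈S oneS
    partialSum-1 a k = trans (+-identityˡ _) (trans (*-congʳ (binom-zero a)) (*-identityˡ _))

    φ⊛xᴹDx : ∀ M → φ s ⊛ (powS x M ⊛ D x) ≈S (powS x M ⊛ D x) ⊕ (powS x (suc M) ⊛ D x)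
    φ⊛xᴹDx M L = begin
      (φ s ⊛ xᴹDx) L                       ≈⟨ ⊛-congˡ xᴹDx φ≈1+x L ⟩
      ((oneS ⊕ x) ⊛ xᴹDx) L                ≈⟨ ⊛-distribʳ-⊕ xᴹDx oneS x L ⟩
      (oneS ⊛ xᴹDx) L + (x ⊛ xᴹDx) L       ≈⟨ +-congʳ (⊛-identityˡ xᴹDx L) ⟩
      xᴹDx L + (x ⊛ xᴹDx) L                ≈⟨ +-congˡ (trans (sym (⊛-assoc x (powS x M) (D x) L)) (⊛-congˡ (D x) (⊛-comm x (powS x M)) L)) ⟩
      xᴹDx L + (powS x (suc M) ⊛ D x) L    ∎
      where
      xᴹDx : Series
      xᴹDx = powS x M ⊛ D x

    -- binom-suc telescopes the sum, leaving only the top term.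
    partialSum-defect : ∀ a M → φ s ⊛ D (partialSum a (suc M)) ≈S
                        a • (D x ⊛ partialSum a (suc M)) ⊝ (binom a (suc M) * ι (suc M)) • (powS x M ⊛ D x)
    partialSum-defect a zero L = begin
      (φ s ⊛ D G) L                  ≈⟨ sumℕ-zero (suc L) (λ i _ → trans (*-congˡ (D-G≈0 (L ∸ i))) (zeroʳ _)) ⟩
      0#                             ≈⟨ sym (-‿inverseʳ _) ⟩
      a * D x L − a * D x L          ≈⟨ +-cong (*-congˡ (sym Dx⊛G≈Dx)) (-‿cong (*-cong (sym b₁ι₁≈a) (sym (⊛-identityˡ (D x) L)))) ⟩
      a * (D x ⊛ G) L − (binom a 1 * ι 1) * (oneS ⊛ D x) L ∎
      where
      G : Series
      G = partialSum a 1
      D-G≈0 : ∀ k → D G k ≈ 0#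
      D-G≈0 zero = zeroˡ _
      D-G≈0 (suc k) = trans (*-congˡ (partialSum-1 a (suc k))) (zeroʳ _)
      Dx⊛G≈Dx : (D x ⊛ G) L ≈ D x L
      Dx⊛G≈Dx = trans (⊛-congʳ (D x) (partialSum-1 a) L) (trans (⊛-comm (D x) oneS L) (⊛-identityˡ (D x) L))
      b₁ι₁≈a : binom a 1 * ι 1 ≈ a
      b₁ι₁≈a = trans (binom-suc a 0) (trans (*-congʳ (trans (+-congˡ -0#≈0#) (+-identityʳ a))) (trans (*-congˡ (binom-zero a)) (*-identityʳ a)))
    partialSum-defect a (suc M) L = begin
      (φ s ⊛ D (G ⊕ b • powS x (suc M))) L
        ≈⟨ trans (⊛-congʳ (φ s) D-step L) (trans (⊛-distribˡ-⊕ (φ s) (D G) (κ • xᴹDx) L) (+-congˡ (⊛-•ʳ (φ s) κ xᴹDx L))) ⟩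
      (φ s ⊛ D G) L + κ * (φ s ⊛ xᴹDx) L
        ≈⟨ +-cong (partialSum-defect a M L) (*-congˡ (φ⊛xᴹDx M L)) ⟩
      (a * P − κ * Y₀) + κ * (Y₀ + Y₁)
        ≈⟨ solve 5 (λ a′ p k y₀ y₁ → (a′ :* p :- k :* y₀) :+ k :* (y₀ :+ y₁) := a′ :* p :+ k :* y₁) refl a P κ Y₀ Y₁ ⟩
      a * P + (b * ι (suc M)) * Y₁
        ≈⟨ solve 5 (λ a′ p b′ m y → a′ :* p :+ (b′ :* m) :* y := a′ :* (p :+ b′ :* y) :- ((a′ :- m) :* b′) :* y) refl a P b (ι (suc M)) Y₁ ⟩
      a * (P + b * Y₁) − ((a − ι (suc M)) * b) * Y₁
        ≈⟨ +-cong (*-congˡ (sym Dx⊛G′)) (-‿cong (*-congʳ (sym (binom-suc a (suc M))))) ⟩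
      a * (D x ⊛ (G ⊕ b • powS x (suc M))) L − (binom a (suc (suc M)) * ι (suc (suc M))) * Y₁ ∎
      where
      G xᴹDx : Series
      G = partialSum a (suc M)
      xᴹDx = powS x M ⊛ D x
      b κ P Y₀ Y₁ : Carrier
      b = binom a (suc M)
      κ = b * ι (suc M)
      P = (D x ⊛ G) L
      Y₀ = xᴹDx L
      Y₁ = (powS x (suc M) ⊛ D x) L
      D-step : D (G ⊕ b • powS x (suc M)) ≈S D G ⊕ κ • xᴹDx
      D-step k = begin
        ι k * (G k + b * powS x (suc M) k)            ≈⟨ trans (distribˡ _ _ _) (+-congˡ (solve 3 (λ i b′ y → i :* (b′ :* y) := b′ :* (i :* y)) refl _ _ _)) ⟩
        D G k + b * D (powS x (suc M)) k              ≈⟨ +-congˡ (*-congˡ (D-powS x M k)) ⟩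
        D G k + b * (ι (suc M) * xᴹDx k)              ≈⟨ +-congˡ (sym (*-assoc _ _ _)) ⟩
        D G k + κ * xᴹDx k                            ∎
      Dx⊛G′ : (D x ⊛ (G ⊕ b • powS x (suc M))) L ≈ P + b * Y₁
      Dx⊛G′ = trans (⊛-distribˡ-⊕ (D x) G (b • powS x (suc M)) L)
                    (+-congˡ (trans (⊛-•ʳ (D x) b (powS x (suc M)) L) (*-congˡ (⊛-comm (D x) (powS x (suc M)) L))))

    PowerODE : Carrier → Series → Set ℓ
    PowerODE a g = φ s ⊛ D g ≈S a • (D (φ s) ⊛ g)

    φ^-ODE : ∀ a → PowerODE a (φ^ a)
    φ^-ODE a L = begin
      (φ s ⊛ D (φ^ a)) L
        ≈⟨ ⊛-cong-upTo L {f = φ s} {g = D (φ^ a)} (λ _ _ → refl) (λ i i≤L → *-congˡ (φ^≈partialSum a L i i≤L)) ⟩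
      (φ s ⊛ D G) L
        ≈⟨ partialSum-defect a L L ⟩
      a * (D x ⊛ G) L − (binom a (suc L) * ι (suc L)) * (powS x L ⊛ D x) L
        ≈⟨ +-congˡ (-‿cong (trans (*-congˡ xᴸDx≈0) (zeroʳ _))) ⟩
      a * (D x ⊛ G) L − 0#
        ≈⟨ trans (+-congˡ -0#≈0#) (+-identityʳ _) ⟩
      a * (D x ⊛ G) L
        ≈⟨ *-congˡ (⊛-cong-upTo L (λ i _ → D-x≈D-φ i) (λ i i≤L → sym (φ^≈partialSum a L i i≤L))) ⟩
      a * (D (φ s) ⊛ φ^ a) L ∎
      where
      G : Series
      G = partialSum a (suc L)
      -- the defect term has order L + 1
      xᴸDx≈0 : (powS x L ⊛ D x) L ≈ 0#
      xᴸDx≈0 = ⊛-vanishesBelow (powS-vanishesBelow x-vanishesBelow-1 L) (D-vanishesBelow-1 x) L (ℕP.m<m+n L (s≤s z≤n))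

    φ^-0 : ∀ a → (φ^ a) 0 ≈ 1#
    φ^-0 a = trans (+-identityˡ _) (trans (*-identityʳ _) (binom-zero a))

    PowerODE-recurrence : ∀ {a g} → PowerODE a g → ∀ L →
      ι (suc L) * g (suc L) ≈ a * sumℕ (suc L) (λ i → D (φ s) (suc i) * g (L ∸ i))
                              − sumℕ (suc L) (λ i → φ s (suc i) * D g (L ∸ i))
    PowerODE-recurrence {a} {g} ode L = begin
      y                                ≈⟨ solve 2 (λ y′ a′ → y′ := (y′ :+ a′) :- a′) refl y A ⟩
      (y + A) − A                      ≈⟨ +-congʳ (sym (trans (sumℕ-suc (suc L) _) (+-congʳ (*-identityˡ _)))) ⟩
      (φ s ⊛ D g) (suc L) − A          ≈⟨ +-congʳ (ode (suc L)) ⟩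
      a * (D (φ s) ⊛ g) (suc L) − A    ≈⟨ +-congʳ (*-congˡ (trans (sumℕ-suc (suc L) _)
                                            (trans (+-congʳ (trans (*-congʳ (zeroˡ _)) (zeroˡ _))) (+-identityˡ _)))) ⟩
      a * B − A                        ∎
      where
      y A B : Carrier
      y = ι (suc L) * g (suc L)
      A = sumℕ (suc L) (λ i → φ s (suc i) * D g (L ∸ i))
      B = sumℕ (suc L) (λ i → D (φ s) (suc i) * g (L ∸ i))

    PowerODE-unique : ∀ {a g h} → g 0 ≈ 1# → h 0 ≈ 1# → PowerODE a g → PowerODE a h → g ≈S h
    PowerODE-unique {a} {g} {h} g₀≈1 h₀≈1 ode-g ode-h L = agreeUpTo L L ℕP.≤-refl
      where
      agreeUpTo : ∀ L i → i ≤ L → g i ≈ h i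
      agreeUpTo zero _ z≤n = trans g₀≈1 (sym h₀≈1)
      agreeUpTo (suc L) i i≤1+L with ℕP.m≤n⇒m<n∨m≡n i≤1+L
      ... | inj₁ i<1+L = agreeUpTo L i (ℕP.≤-pred i<1+L)
      ... | inj₂ Eq.refl = *-cancelˡ (ι (suc L)) (char0 L) (begin
        ι (suc L) * g (suc L)
          ≈⟨ PowerODE-recurrence {g = g} ode-g L ⟩
        a * sumℕ (suc L) (λ i → D (φ s) (suc i) * g (L ∸ i)) − sumℕ (suc L) (λ i → φ s (suc i) * D g (L ∸ i))
          ≈⟨ +-cong (*-congˡ (sumℕ-cong (suc L) (λ i _ → *-congˡ (g≈h i))))
                    (-‿cong (sumℕ-cong (suc L) (λ i _ → *-congˡ (*-congˡ (g≈h i))))) ⟩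
        a * sumℕ (suc L) (λ i → D (φ s) (suc i) * h (L ∸ i)) − sumℕ (suc L) (λ i → φ s (suc i) * D h (L ∸ i))
          ≈⟨ sym (PowerODE-recurrence {g = h} ode-h L) ⟩
        ι (suc L) * h (suc L) ∎)
        where
        g≈h : ∀ i → g (L ∸ i) ≈ h (L ∸ i)
        g≈h i = agreeUpTo L (L ∸ i) (ℕP.m∸n≤m L i)

    φ^-+ : ∀ a b → φ^ a ⊛ φ^ b ≈S φ^ (a + b)
    φ^-+ a b = PowerODE-unique h₀≈1 (φ^-0 (a + b)) ode-h (φ^-ODE (a + b))
      where
      h : Series
      h = φ^ a ⊛ φ^ b
      h₀≈1 : h 0 ≈ 1#
      h₀≈1 = trans (+-identityˡ _) (trans (*-cong (φ^-0 a) (φ^-0 b)) (*-identityˡ _))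
      ode-h : PowerODE (a + b) h
      ode-h L = begin
        (φ s ⊛ D h) L
          ≈⟨ ⊛-congʳ (φ s) (D-Leibniz (φ^ a) (φ^ b)) L ⟩
        (φ s ⊛ ((D (φ^ a) ⊛ φ^ b) ⊕ (φ^ a ⊛ D (φ^ b)))) L
          ≈⟨ ⊛-distribˡ-⊕ (φ s) (D (φ^ a) ⊛ φ^ b) (φ^ a ⊛ D (φ^ b)) L ⟩
        (φ s ⊛ (D (φ^ a) ⊛ φ^ b)) L + (φ s ⊛ (φ^ a ⊛ D (φ^ b))) L
          ≈⟨ +-cong left right ⟩
        a * (D (φ s) ⊛ h) L + b * (D (φ s) ⊛ h) L
          ≈⟨ sym (distribʳ _ _ _) ⟩
        (a + b) * (D (φ s) ⊛ h) L ∎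
        where
        left : (φ s ⊛ (D (φ^ a) ⊛ φ^ b)) L ≈ a * (D (φ s) ⊛ h) L
        left = begin
          (φ s ⊛ (D (φ^ a) ⊛ φ^ b)) L          ≈⟨ sym (⊛-assoc (φ s) (D (φ^ a)) (φ^ b) L) ⟩
          ((φ s ⊛ D (φ^ a)) ⊛ φ^ b) L          ≈⟨ ⊛-congˡ (φ^ b) (φ^-ODE a) L ⟩
          ((a • (D (φ s) ⊛ φ^ a)) ⊛ φ^ b) L    ≈⟨ ⊛-•ˡ (φ^ b) a (D (φ s) ⊛ φ^ a) L ⟩
          a * ((D (φ s) ⊛ φ^ a) ⊛ φ^ b) L      ≈⟨ *-congˡ (⊛-assoc (D (φ s)) (φ^ a) (φ^ b) L) ⟩
          a * (D (φ s) ⊛ h) L                  ∎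
        right : (φ s ⊛ (φ^ a ⊛ D (φ^ b))) L ≈ b * (D (φ s) ⊛ h) L
        right = begin
          (φ s ⊛ (φ^ a ⊛ D (φ^ b))) L          ≈⟨ sym (⊛-assoc (φ s) (φ^ a) (D (φ^ b)) L) ⟩
          ((φ s ⊛ φ^ a) ⊛ D (φ^ b)) L          ≈⟨ ⊛-swapʳ (φ s) (φ^ a) (D (φ^ b)) L ⟩
          ((φ s ⊛ D (φ^ b)) ⊛ φ^ a) L          ≈⟨ ⊛-congˡ (φ^ a) (φ^-ODE b) L ⟩
          ((b • (D (φ s) ⊛ φ^ b)) ⊛ φ^ a) L    ≈⟨ ⊛-•ˡ (φ^ a) b (D (φ s) ⊛ φ^ b) L ⟩
          b * ((D (φ s) ⊛ φ^ b) ⊛ φ^ a) L      ≈⟨ *-congˡ (trans (⊛-swapʳ (D (φ s)) (φ^ b) (φ^ a) L) (⊛-assoc (D (φ s)) (φ^ a) (φ^ b) L)) ⟩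
          b * (D (φ s) ⊛ h) L                  ∎

    ρ : Carrier → Series
    ρ R = R • φ s ⊝ D (φ s)

    ⊛-ρ : ∀ R g → g ⊛ ρ R ≈S R • (g ⊛ φ s) ⊝ g ⊛ D (φ s)
    ⊛-ρ R g L = trans (⊛-distribˡ-⊝ g (R • φ s) (D (φ s)) L) (+-congʳ (⊛-•ʳ g R (φ s) L))

    φ^⊛ρ : ∀ R a L → (a + 1#) * R ≈ ι L → (φ^ a ⊛ ρ R) L ≈ R * oneS L
    φ^⊛ρ R a zero _ = begin
      0# + (φ^ a) 0 * (R * 1# − 0# * 1#)   ≈⟨ trans (+-identityˡ _) (*-congʳ (φ^-0 a)) ⟩
      1# * (R * 1# − 0# * 1#)              ≈⟨ trans (*-identityˡ _) (trans (+-congˡ (trans (-‿cong (zeroˡ _)) -0#≈0#)) (+-identityʳ _)) ⟩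
      R * 1#                               ∎
    φ^⊛ρ R a (suc L) a+1*R≈1+L = *-cancelˡ (a + 1#) a+1≉0 (begin
      (a + 1#) * (φ^ a ⊛ ρ R) (suc L)   ≈⟨ *-congˡ (⊛-ρ R (φ^ a) (suc L)) ⟩
      (a + 1#) * (R * χ − Z)            ≈⟨ solve 4 (λ a′ R′ χ′ Z′ → a′ :* (R′ :* χ′ :- Z′) := (a′ :* R′) :* χ′ :- a′ :* Z′) refl (a + 1#) R χ Z ⟩
      ((a + 1#) * R) * χ − (a + 1#) * Z ≈⟨ +-cong (*-congʳ a+1*R≈1+L) (-‿cong (sym tD-χ)) ⟩
      ι (suc L) * χ − ι (suc L) * χ     ≈⟨ -‿inverseʳ _ ⟩
      0#                                ≈⟨ sym (trans (*-congˡ (zeroʳ R)) (zeroʳ _)) ⟩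
      (a + 1#) * (R * 0#)               ∎)
      where
      χ Z : Carrier
      χ = (φ^ a ⊛ φ s) (suc L)
      Z = (φ^ a ⊛ D (φ s)) (suc L)
      a+1≉0 : ¬ (a + 1# ≈ 0#)
      a+1≉0 a+1≈0 = char0 L (trans (sym a+1*R≈1+L) (trans (*-congʳ a+1≈0) (zeroˡ R)))
      tD-χ : ι (suc L) * χ ≈ (a + 1#) * Z
      tD-χ = begin
        ι (suc L) * χ                          ≈⟨ D-Leibniz (φ^ a) (φ s) (suc L) ⟩
        (D (φ^ a) ⊛ φ s) (suc L) + Z           ≈⟨ +-congʳ (trans (⊛-comm (D (φ^ a)) (φ s) (suc L)) (φ^-ODE a (suc L))) ⟩
        a * (D (φ s) ⊛ φ^ a) (suc L) + Z       ≈⟨ +-cong (*-congˡ (⊛-comm (D (φ s)) (φ^ a) (suc L))) (sym (*-identityˡ Z)) ⟩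
        a * Z + 1# * Z                         ≈⟨ sym (distribʳ _ _ _) ⟩
        (a + 1#) * Z                           ∎

    φ^-weighted : ∀ R a e n → e ≈ R * a →
                  n • (ρ R ⊛ φ^ a) ⊝ φ s ⊛ (e • φ^ a ⊝ D (φ^ a)) ≈S (n − a) • (φ^ a ⊛ ρ R)
    φ^-weighted R a e n e≈Ra L = begin
      n * (ρ R ⊛ q) L − (φ s ⊛ (e • q ⊝ D q)) L
        ≈⟨ +-cong (*-congˡ (⊛-comm (ρ R) q L)) (-‿cong (⊛-distribˡ-⊝ (φ s) (e • q) (D q) L)) ⟩
      n * W − ((φ s ⊛ (e • q)) L − (φ s ⊛ D q) L)
        ≈⟨ +-congˡ (-‿cong (+-cong (trans (⊛-•ʳ (φ s) e q L) (*-cong e≈Ra (⊛-comm (φ s) q L)))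
                                   (-‿cong (trans (φ^-ODE a L) (*-congˡ (⊛-comm (D (φ s)) q L)))))) ⟩
      n * W − ((R * a) * A − a * B)
        ≈⟨ solve 6 (λ n′ W′ R′ a′ A′ B′ → n′ :* W′ :- ((R′ :* a′) :* A′ :- a′ :* B′) := n′ :* W′ :- a′ :* (R′ :* A′ :- B′)) refl n W R a A B ⟩
      n * W − a * (R * A − B)
        ≈⟨ +-congˡ (-‿cong (*-congˡ (sym (⊛-ρ R q L)))) ⟩
      n * W − a * W
        ≈⟨ solve 3 (λ n′ a′ W′ → n′ :* W′ :- a′ :* W′ := (n′ :- a′) :* W′) refl n a W ⟩
      (n − a) * W ∎
      where
      q : Series
      q = φ^ a
      W A B : Carrier
      W = (q ⊛ ρ R) L
      A = (q ⊛ φ s) L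
      B = (q ⊛ D (φ s)) L

  -- Matrices

  sumFin-cong : ∀ {m} {f g : Fin m → Carrier} → (∀ k → f k ≈ g k) → sumFin f ≈ sumFin g
  sumFin-cong {zero} f≈g = refl
  sumFin-cong {suc m} f≈g = +-cong (f≈g Fin.zero) (sumFin-cong (λ k → f≈g (Fin.suc k)))

  sumFin≈sumℕ : ∀ m (f : ℕ → Carrier) → sumFin {m} (λ k → f (toℕ k)) ≈ sumℕ m f
  sumFin≈sumℕ zero f = refl
  sumFin≈sumℕ (suc m) f = trans (+-congˡ (sumFin≈sumℕ m (λ k → f (suc k)))) (sym (sumℕ-suc m f))

  sumFin-zero : ∀ {m} {f : Fin m → Carrier} → (∀ k → f k ≈ 0#) → sumFin f ≈ 0#
  sumFin-zero {zero} f≈0 = refl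
  sumFin-zero {suc m} f≈0 = trans (+-cong (f≈0 Fin.zero) (sumFin-zero (λ k → f≈0 (Fin.suc k)))) (+-identityˡ _)

  sumFin-+ : ∀ {m} (f g : Fin m → Carrier) → sumFin (λ k → f k + g k) ≈ sumFin f + sumFin g
  sumFin-+ {zero} f g = sym (+-identityˡ _)
  sumFin-+ {suc m} f g = trans (+-congˡ (sumFin-+ (λ k → f (Fin.suc k)) (λ k → g (Fin.suc k))))
    (solve 4 (λ a b x y → (a :+ b) :+ (x :+ y) := (a :+ x) :+ (b :+ y)) refl _ _ _ _)

  sumFin-*ˡ : ∀ {m} x (f : Fin m → Carrier) → sumFin (λ k → x * f k) ≈ x * sumFin f
  sumFin-*ˡ {zero} x f = sym (zeroʳ _)
  sumFin-*ˡ {suc m} x f = trans (+-congˡ (sumFin-*ˡ x (λ k → f (Fin.suc k)))) (sym (distribˡ _ _ _))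

  sumFin-*ʳ : ∀ {m} x (f : Fin m → Carrier) → sumFin (λ k → f k * x) ≈ sumFin f * x
  sumFin-*ʳ {m} x f = trans (sumFin-cong {m} (λ _ → *-comm _ _)) (trans (sumFin-*ˡ x f) (*-comm _ _))

  sumFin-− : ∀ {m} (f g : Fin m → Carrier) → sumFin (λ k → f k − g k) ≈ sumFin f − sumFin g
  sumFin-− f g = trans (sumFin-+ f (λ k → - g k)) (+-congˡ (-sum g))
    where
    -sum : ∀ {m} (g : Fin m → Carrier) → sumFin (λ k → - g k) ≈ - sumFin g
    -sum {zero} g = sym -0#≈0#
    -sum {suc m} g = trans (+-congˡ (-sum (λ k → g (Fin.suc k)))) (-‿+-comm _ _)

  sumFin-swap : ∀ {m p} (G : Fin m → Fin p → Carrier) →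
                sumFin (λ k → sumFin (λ l → G k l)) ≈ sumFin (λ l → sumFin (λ k → G k l))
  sumFin-swap {zero} {p} G = sym (sumFin-zero {p} (λ _ → refl))
  sumFin-swap {suc m} {p} G = trans (+-congˡ (sumFin-swap (λ k l → G (Fin.suc k) l)))
    (sym (sumFin-+ {p} (λ l → G Fin.zero l) (λ l → sumFin (λ k → G (Fin.suc k) l))))

  infixl 7 _·ᵥ_
  _·ᵥ_ : ∀ {m} → Mat m → (Fin m → Carrier) → Fin m → Carrier
  (A ·ᵥ v) i = sumFin (λ k → A i k * v k)

  ·ᵥ-assoc : ∀ {m} (B A : Mat m) v i → (B ·ᵥ (A ·ᵥ v)) i ≈ ((B · A) ·ᵥ v) i
  ·ᵥ-assoc {m} B A v i = begin
    sumFin (λ k → B i k * sumFin (λ l → A k l * v l))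
      ≈⟨ sumFin-cong {m} (λ k → sym (sumFin-*ˡ (B i k) (λ l → A k l * v l))) ⟩
    sumFin (λ k → sumFin (λ l → B i k * (A k l * v l)))
      ≈⟨ sumFin-swap {m} {m} (λ k l → B i k * (A k l * v l)) ⟩
    sumFin (λ l → sumFin (λ k → B i k * (A k l * v l)))
      ≈⟨ sumFin-cong {m} (λ l → trans (sumFin-cong {m} (λ k → sym (*-assoc _ _ _))) (sumFin-*ʳ (v l) (λ k → B i k * A k l))) ⟩
    sumFin (λ l → (B · A) i l * v l) ∎

  ·-assoc : ∀ {m} (A B C : Mat m) → ((A · B) · C) ≈M (A · (B · C))
  ·-assoc A B C i j = sym (·ᵥ-assoc A B (λ l → C l j) i)

  ·-congʳ : ∀ {m} {A A′ : Mat m} (B : Mat m) → A ≈M A′ → (A · B) ≈M (A′ · B)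
  ·-congʳ {m} B A≈A′ i j = sumFin-cong {m} (λ k → *-congʳ (A≈A′ i k))

  scal-·ˡ : ∀ {m} x (A B : Mat m) → (scal x A · B) ≈M scal x (A · B)
  scal-·ˡ {m} x A B i j = trans (sumFin-cong {m} (λ k → *-assoc _ _ _)) (sumFin-*ˡ x (λ k → A i k * B k j))

  scal-·ʳ : ∀ {m} x (A B : Mat m) → (A · scal x B) ≈M scal x (A · B)
  scal-·ʳ {m} x A B i j =
    trans (sumFin-cong {m} (λ k → solve 3 (λ a y b → a :* (y :* b) := y :* (a :* b)) refl _ _ _)) (sumFin-*ˡ x (λ k → A i k * B k j))

  diag-suc : ∀ {m} (d : Fin (suc m) → Carrier) i j → diag d (Fin.suc i) (Fin.suc j) ≈ diag (λ k → d (Fin.suc k)) i j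
  -- ℕ._≟_ is map′ of the test _≡ᵇ_, which strips suc on both sides.
  diag-suc d i j =
    reflexive (Eq.cong (λ b → if b then d (Fin.suc i) else 0#) (Eq.trans (⌊⌋-map′ _ _ _) (Eq.sym (⌊⌋-map′ _ _ _))))

  sumFin-*-diag : ∀ {m} (v d : Fin m → Carrier) j → sumFin (λ k → v k * diag d k j) ≈ v j * d j
  sumFin-*-diag {suc m} v d Fin.zero = trans (+-congˡ (sumFin-zero {m} (λ _ → zeroʳ _))) (+-identityʳ _)
  sumFin-*-diag {suc m} v d (Fin.suc j) =
    trans (+-congʳ (zeroʳ _)) (trans (+-identityˡ _) (trans (sumFin-cong (λ k → *-congˡ (diag-suc d k j)))
      (sumFin-*-diag (λ k → v (Fin.suc k)) (λ k → d (Fin.suc k)) j)))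

  sumFin-diag-* : ∀ {m} (d v : Fin m → Carrier) i → sumFin (λ k → diag d i k * v k) ≈ d i * v i
  sumFin-diag-* {suc m} d v Fin.zero = trans (+-congˡ (sumFin-zero {m} (λ _ → zeroˡ _))) (+-identityʳ _)
  sumFin-diag-* {suc m} d v (Fin.suc i) =
    trans (+-congʳ (zeroˡ _)) (trans (+-identityˡ _) (trans (sumFin-cong (λ k → *-congʳ (diag-suc d i k)))
      (sumFin-diag-* (λ k → d (Fin.suc k)) (λ k → v (Fin.suc k)) i)))

  LowerTriangular : ∀ {m} → Mat m → Set ℓ
  LowerTriangular A = ∀ i j → toℕ i < toℕ j → A i j ≈ 0#

  -- Block induction: write A = [a 0; u A′] and B = [b e; w B′].
  lower-rightInverse⇒leftInverse : ∀ {m} (A B : Mat m) → LowerTriangular A → (A · B) ≈M idM → (B · A) ≈M idM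
  lower-rightInverse⇒leftInverse {zero} A B _ _ ()
  lower-rightInverse⇒leftInverse {suc m} A B A-lower AB≈I = BA≈I
    where
    a b : Carrier
    a = A Fin.zero Fin.zero
    b = B Fin.zero Fin.zero
    u w : Fin m → Carrier
    u i = A (Fin.suc i) Fin.zero
    w i = B (Fin.suc i) Fin.zero
    A′ B′ : Mat m
    A′ i j = A (Fin.suc i) (Fin.suc j)
    B′ i j = B (Fin.suc i) (Fin.suc j)

    A₀ₖ≈0 : ∀ k → A Fin.zero (Fin.suc k) ≈ 0#
    A₀ₖ≈0 k = A-lower Fin.zero (Fin.suc k) (s≤s z≤n)

    aB₀ⱼ≈I₀ⱼ : ∀ j → a * B Fin.zero j ≈ idM Fin.zero j
    aB₀ⱼ≈I₀ⱼ j = trans (sym (trans (+-congˡ (sumFin-zero {m} (λ k → trans (*-congʳ (A₀ₖ≈0 k)) (zeroˡ _)))) (+-identityʳ _)))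
                       (AB≈I Fin.zero j)

    ab≈1 : a * b ≈ 1#
    ab≈1 = aB₀ⱼ≈I₀ⱼ Fin.zero

    a≉0 : ¬ (a ≈ 0#)
    a≉0 a≈0 = char0 0 (trans ι1≈1 (trans (sym ab≈1) (trans (*-congʳ a≈0) (zeroˡ _))))

    B₀ₖ≈0 : ∀ k → B Fin.zero (Fin.suc k) ≈ 0#
    B₀ₖ≈0 k = *-cancelˡ a a≉0 (trans (aB₀ⱼ≈I₀ⱼ (Fin.suc k)) (sym (zeroʳ a)))

    A′B′≈I : (A′ · B′) ≈M idM
    A′B′≈I i j = trans (sym (trans (+-congʳ (trans (*-congˡ (B₀ₖ≈0 j)) (zeroʳ _))) (+-identityˡ _)))
                       (trans (AB≈I (Fin.suc i) (Fin.suc j)) (diag-suc (λ _ → 1#) i j))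

    B′A′≈I : (B′ · A′) ≈M idM
    B′A′≈I = lower-rightInverse⇒leftInverse A′ B′ (λ i j i<j → A-lower (Fin.suc i) (Fin.suc j) (s≤s i<j)) A′B′≈I

    v : Fin m → Carrier
    v = B′ ·ᵥ u

    w≈-vb : ∀ i → w i ≈ - (v i * b)
    w≈-vb i = begin
      w i                          ≈⟨ solve 2 (λ y z → y := (z :+ y) :- z) refl (w i) (v i * b) ⟩
      (v i * b + w i) − v i * b    ≈⟨ trans (+-congʳ vb+w≈0) (+-identityˡ _) ⟩
      - (v i * b)                  ∎
      where
      vb+w≈0 : v i * b + w i ≈ 0#
      vb+w≈0 = begin
        v i * b + w i
          ≈⟨ +-cong (sym (sumFin-*ʳ b (λ k → B′ i k * u k))) (sym (trans (sumFin-diag-* (λ _ → 1#) w i) (*-identityˡ _))) ⟩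
        sumFin (λ k → B′ i k * u k * b) + (idM ·ᵥ w) i
          ≈⟨ +-cong (sumFin-cong {m} (λ k → *-assoc _ _ _)) (sumFin-cong {m} (λ l → *-congʳ (sym (B′A′≈I i l)))) ⟩
        sumFin (λ k → B′ i k * (u k * b)) + ((B′ · A′) ·ᵥ w) i
          ≈⟨ +-congˡ (sym (·ᵥ-assoc B′ A′ w i)) ⟩
        sumFin (λ k → B′ i k * (u k * b)) + sumFin (λ k → B′ i k * (A′ ·ᵥ w) k)
          ≈⟨ sym (sumFin-+ (λ k → B′ i k * (u k * b)) (λ k → B′ i k * (A′ ·ᵥ w) k)) ⟩
        sumFin (λ k → B′ i k * (u k * b) + B′ i k * (A′ ·ᵥ w) k)
          ≈⟨ sumFin-zero {m} (λ k → trans (sym (distribˡ _ _ _)) (trans (*-congˡ (AB≈I (Fin.suc k) Fin.zero)) (zeroʳ _))) ⟩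
        0# ∎

    BA≈I : (B · A) ≈M idM
    BA≈I Fin.zero Fin.zero =
      trans (+-cong (*-comm _ _) (sumFin-zero {m} (λ k → trans (*-congʳ (B₀ₖ≈0 k)) (zeroˡ _)))) (trans (+-identityʳ _) ab≈1)
    BA≈I Fin.zero (Fin.suc j) =
      trans (+-cong (trans (*-congˡ (A₀ₖ≈0 j)) (zeroʳ _)) (sumFin-zero {m} (λ k → trans (*-congʳ (B₀ₖ≈0 k)) (zeroˡ _)))) (+-identityʳ _)
    BA≈I (Fin.suc i) Fin.zero = begin
      w i * a + v i              ≈⟨ +-congʳ (*-congʳ (w≈-vb i)) ⟩
      - (v i * b) * a + v i      ≈⟨ solve 3 (λ y b′ a′ → :- (y :* b′) :* a′ :+ y := y :- y :* (a′ :* b′)) refl (v i) b a ⟩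
      v i − v i * (a * b)        ≈⟨ +-congˡ (-‿cong (trans (*-congˡ ab≈1) (*-identityʳ _))) ⟩
      v i − v i                  ≈⟨ -‿inverseʳ _ ⟩
      0#                         ∎
    BA≈I (Fin.suc i) (Fin.suc j) =
      trans (+-congʳ (trans (*-congˡ (A₀ₖ≈0 j)) (zeroʳ _))) (trans (+-identityˡ _) (trans (B′A′≈I i j) (sym (diag-suc (λ _ → 1#) i j))))

  -- lowerEntry a i j unfolds to lowerℕ a (toℕ i) (toℕ j).
  lowerℕ : Series → ℕ → ℕ → Carrier
  lowerℕ a I J = if ⌊ J ≤? I ⌋ then a (I ∸ J) else 0#

  lowerℕ-≤ : ∀ a {I J} → J ≤ I → lowerℕ a I J ≈ a (I ∸ J)
  lowerℕ-≤ a {I} {J} J≤I with J ≤? I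
  ... | yes _ = refl
  ... | no J≰I = contradiction J≤I J≰I

  lowerℕ-< : ∀ a {I J} → I < J → lowerℕ a I J ≈ 0#
  lowerℕ-< a {I} {J} I<J with J ≤? I
  ... | yes J≤I = contradiction J≤I (ℕP.<⇒≱ I<J)
  ... | no _ = refl

  sumℕ-lowerℕ : ∀ m a b I J → I < m → sumℕ m (λ k → lowerℕ a I k * lowerℕ b k J) ≈ lowerℕ (a ⊛ b) I J
  sumℕ-lowerℕ m a b I J I<m with J ≤? I
  ... | no J≰I = sumℕ-zero m term
    where
    term : ∀ k → k < m → lowerℕ a I k * lowerℕ b k J ≈ 0#
    term k _ with k ≤? I
    ... | yes k≤I = trans (*-congˡ (lowerℕ-< b (ℕP.≤-<-trans k≤I (ℕP.≰⇒> J≰I)))) (zeroʳ _)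
    ... | no _ = zeroˡ _
  ... | yes J≤I = begin
    sumℕ m f                                                              ≈⟨ reflexive (Eq.cong (λ t → sumℕ t f) (Eq.sym J+[1+L+R]≡m)) ⟩
    sumℕ (J ℕ.+ (suc L ℕ.+ R)) f                                          ≈⟨ sumℕ-split J (suc L ℕ.+ R) f ⟩
    sumℕ J f + sumℕ (suc L ℕ.+ R) (λ t → f (J ℕ.+ t))                      ≈⟨ +-congˡ (sumℕ-split (suc L) R (λ t → f (J ℕ.+ t))) ⟩
    sumℕ J f + (sumℕ (suc L) (λ t → f (J ℕ.+ t)) + sumℕ R (λ u → f (J ℕ.+ (suc L ℕ.+ u))))
                                                                          ≈⟨ +-cong below (+-cong window above) ⟩
    0# + ((b ⊛ a) L + 0#)                                                 ≈⟨ trans (+-identityˡ _) (+-identityʳ _) ⟩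
    (b ⊛ a) L                                                             ≈⟨ ⊛-comm b a L ⟩
    (a ⊛ b) L                                                             ∎
    where
    L R : ℕ
    L = I ∸ J
    R = m ∸ suc I
    f : ℕ → Carrier
    f k = lowerℕ a I k * lowerℕ b k J
    J+[1+L]≡1+I : J ℕ.+ suc L ≡ suc I
    J+[1+L]≡1+I = Eq.trans (ℕP.+-suc J L) (Eq.cong suc (ℕP.m+[n∸m]≡n J≤I))
    J+[1+L+R]≡m : J ℕ.+ (suc L ℕ.+ R) ≡ m
    J+[1+L+R]≡m = Eq.trans (Eq.sym (ℕP.+-assoc J (suc L) R)) (Eq.trans (Eq.cong (ℕ._+ R) J+[1+L]≡1+I) (ℕP.m+[n∸m]≡n I<m))
    below : sumℕ J f ≈ 0#
    below = sumℕ-zero J (λ k k<J → trans (*-congˡ (lowerℕ-< b k<J)) (zeroʳ _))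
    window : sumℕ (suc L) (λ t → f (J ℕ.+ t)) ≈ (b ⊛ a) L
    window = sumℕ-cong (suc L) (λ t t≤L → begin
      lowerℕ a I (J ℕ.+ t) * lowerℕ b (J ℕ.+ t) J
        ≈⟨ *-cong (lowerℕ-≤ a (Eq.subst (J ℕ.+ t ≤_) (ℕP.m+[n∸m]≡n J≤I) (ℕP.+-monoʳ-≤ J (ℕP.≤-pred t≤L))))
                  (lowerℕ-≤ b (ℕP.m≤m+n J t)) ⟩
      a (I ∸ (J ℕ.+ t)) * b (J ℕ.+ t ∸ J)
        ≈⟨ trans (*-comm _ _) (*-cong (reflexive (Eq.cong b (ℕP.m+n∸m≡n J t))) (reflexive (Eq.cong a (Eq.sym (ℕP.∸-+-assoc I J t))))) ⟩
      b t * a (L ∸ t) ∎)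
    above : sumℕ R (λ u → f (J ℕ.+ (suc L ℕ.+ u))) ≈ 0#
    above = sumℕ-zero R (λ u _ → trans (*-congʳ (lowerℕ-< a (I<J+[1+L+u] u))) (zeroˡ _))
      where
      I<J+[1+L+u] : ∀ u → I < J ℕ.+ (suc L ℕ.+ u)
      I<J+[1+L+u] u = Eq.subst (suc I ≤_)
        (Eq.sym (Eq.trans (Eq.sym (ℕP.+-assoc J (suc L) u)) (Eq.cong (ℕ._+ u) J+[1+L]≡1+I))) (ℕP.m≤m+n (suc I) u)

  sumFin-lowerEntry : ∀ {m} a b (i j : Fin m) →
                      sumFin (λ k → lowerEntry a i k * lowerEntry b k j) ≈ lowerEntry (a ⊛ b) i j
  sumFin-lowerEntry {m} a b i j = trans (sumFin≈sumℕ m (λ k → lowerℕ a (toℕ i) k * lowerℕ b k (toℕ j)))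
                                        (sumℕ-lowerℕ m a b (toℕ i) (toℕ j) (FinP.toℕ<n i))

  lowerEntry-cong : ∀ {m} a b (i j : Fin m) → (toℕ j ≤ toℕ i → a (toℕ i ∸ toℕ j) ≈ b (toℕ i ∸ toℕ j)) →
                    lowerEntry a i j ≈ lowerEntry b i j
  lowerEntry-cong a b i j a≈b with toℕ j ≤? toℕ i
  ... | yes j≤i = a≈b j≤i
  ... | no _ = refl

  lowerEntry-• : ∀ {m} x a (i j : Fin m) → x * lowerEntry a i j ≈ lowerEntry (x • a) i j
  lowerEntry-• x a i j with toℕ j ≤? toℕ i
  ... | yes _ = refl
  ... | no _ = zeroʳ x

  lowerEntry-⊝ : ∀ {m} a b (i j : Fin m) → lowerEntry a i j − lowerEntry b i j ≈ lowerEntry (a ⊝ b) i j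
  lowerEntry-⊝ a b i j with toℕ j ≤? toℕ i
  ... | yes _ = refl
  ... | no _ = trans (+-congˡ -0#≈0#) (+-identityʳ 0#)

  idM≈lowerEntry-oneS : ∀ {m} (i j : Fin m) → idM i j ≈ lowerEntry oneS i j
  idM≈lowerEntry-oneS i j with toℕ i ℕ.≟ toℕ j | toℕ j ≤? toℕ i
  ... | yes i≡j | yes _ = reflexive (Eq.cong oneS (Eq.sym (Eq.trans (Eq.cong (_∸ toℕ j) i≡j) (ℕP.n∸n≡0 (toℕ j)))))
  ... | yes i≡j | no j≰i = contradiction (ℕP.≤-reflexive (Eq.sym i≡j)) j≰i
  ... | no i≢j | yes j≤i = sym (oneS-≢0 (λ i∸j≡0 → i≢j (ℕP.≤-antisym (ℕP.m∸n≡0⇒m≤n i∸j≡0) j≤i)))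
    where
    oneS-≢0 : ∀ {n} → n ≢ 0 → oneS n ≈ 0#
    oneS-≢0 {zero} 0≢0 = contradiction Eq.refl 0≢0
    oneS-≢0 {suc n} _ = refl
  ... | no _ | no _ = refl

  module R₁Factorisation {r : ℕ} (s : Fin r → Carrier) (n : Carrier) (r≉0 : ¬ (ι r ≈ 0#)) where
    open Lemma13Objects r s n
    open Powers s

    R r⁻¹ : Carrier
    R = ι r
    r⁻¹ = R ⁻¹

    M : Mat r
    M i j = lowerEntry (r⁻¹ • (φ^ μs j ⊛ ρ R)) i j

    λᵢ+μⱼ+1 : ∀ i j → toℕ j ≤ toℕ i → (λs i + μs j + 1#) * R ≈ ι (toℕ i ∸ toℕ j)
    λᵢ+μⱼ+1 i j j≤i = begin
      (- (b * r⁻¹) + a * r⁻¹ + 1#) * R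
        ≈⟨ distribʳ _ _ _ ⟩
      (- (b * r⁻¹) + a * r⁻¹) * R + 1# * R
        ≈⟨ +-cong (solve 4 (λ a′ b′ ri R′ → (:- (b′ :* ri) :+ a′ :* ri) :* R′ := (a′ :- b′) :* (ri :* R′)) refl a b r⁻¹ R)
                  (*-identityˡ R) ⟩
      (a − b) * (r⁻¹ * R) + R
        ≈⟨ +-congʳ (trans (*-congˡ (⁻¹-inverseˡ R r≉0)) (*-identityʳ _)) ⟩
      a − b + R
        ≈⟨ +-congʳ (+-cong (ι-∸ r (suc J) (FinP.toℕ<n j))
                           (-‿cong (trans (ι-∸ (r ℕ.+ r) (suc I) (ℕP.≤-trans (FinP.toℕ<n i) (ℕP.m≤m+n r r))) (+-congʳ (ι-+ r r))))) ⟩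
      (R − (1# + ι J)) − ((R + R) − (1# + ι I)) + R
        ≈⟨ solve 4 (λ R′ o i′ j′ → (R′ :- (o :+ j′)) :- ((R′ :+ R′) :- (o :+ i′)) :+ R′ := i′ :- j′) refl R 1# (ι I) (ι J) ⟩
      ι I − ι J
        ≈⟨ sym (ι-∸ I J j≤i) ⟩
      ι (I ∸ J) ∎
      where
      I J : ℕ
      I = toℕ i
      J = toℕ j
      a b : Carrier
      a = ι (r ∸ suc J)
      b = ι ((r ℕ.+ r) ∸ suc I)

    P·M≈I : (Pmat s λs · M) ≈M idM
    P·M≈I i j = begin
      (Pmat s λs · M) i j                                   ≈⟨ sumFin-lowerEntry (φ^ λs i) (r⁻¹ • (φ^ μs j ⊛ ρ R)) i j ⟩
      lowerEntry (φ^ λs i ⊛ (r⁻¹ • (φ^ μs j ⊛ ρ R))) i j     ≈⟨ lowerEntry-cong (φ^ λs i ⊛ (r⁻¹ • (φ^ μs j ⊛ ρ R))) oneS i j coefficient ⟩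
      lowerEntry oneS i j                                   ≈⟨ sym (idM≈lowerEntry-oneS i j) ⟩
      idM i j                                               ∎
      where
      L : ℕ
      L = toℕ i ∸ toℕ j
      coefficient : toℕ j ≤ toℕ i → (φ^ λs i ⊛ (r⁻¹ • (φ^ μs j ⊛ ρ R))) L ≈ oneS L
      coefficient j≤i = begin
        (φ^ λs i ⊛ (r⁻¹ • (φ^ μs j ⊛ ρ R))) L    ≈⟨ ⊛-•ʳ (φ^ λs i) r⁻¹ (φ^ μs j ⊛ ρ R) L ⟩
        r⁻¹ * (φ^ λs i ⊛ (φ^ μs j ⊛ ρ R)) L      ≈⟨ *-congˡ (sym (⊛-assoc (φ^ λs i) (φ^ μs j) (ρ R) L)) ⟩
        r⁻¹ * ((φ^ λs i ⊛ φ^ μs j) ⊛ ρ R) L      ≈⟨ *-congˡ (⊛-congˡ (ρ R) (φ^-+ (λs i) (μs j)) L) ⟩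
        r⁻¹ * (φ^ (λs i + μs j) ⊛ ρ R) L         ≈⟨ *-congˡ (φ^⊛ρ R (λs i + μs j) L (λᵢ+μⱼ+1 i j j≤i)) ⟩
        r⁻¹ * (R * oneS L)                       ≈⟨ sym (*-assoc _ _ _) ⟩
        (r⁻¹ * R) * oneS L                       ≈⟨ trans (*-congʳ (⁻¹-inverseˡ R r≉0)) (*-identityˡ _) ⟩
        oneS L                                   ∎

    M·P≈I : (M · Pmat s λs) ≈M idM
    M·P≈I = lower-rightInverse⇒leftInverse (Pmat s λs) M (λ i j i<j → lowerℕ-< (φ^ λs i) i<j) P·M≈I

    dₖ : Fin r → Carrier
    dₖ k = ι (r ∸ suc (toℕ k))

    R₁-entry : ∀ i k → R₁ i k ≈ n * lowerEntry (ρ R) i k − lowerEntry (φ s) i k * dₖ k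
    R₁-entry i k = +-congˡ (-‿cong (sumFin-*-diag (λ l → Smat r (φ s) i l) dₖ k))

    R₁-lower : LowerTriangular R₁
    R₁-lower i j i<j = begin
      R₁ i j                                                ≈⟨ R₁-entry i j ⟩
      n * lowerEntry (ρ R) i j − lowerEntry (φ s) i j * dₖ j  ≈⟨ +-cong (*-congˡ (lowerℕ-< (ρ R) i<j)) (-‿cong (*-congʳ (lowerℕ-< (φ s) i<j))) ⟩
      n * 0# − 0# * dₖ j                                     ≈⟨ solve 2 (λ n′ d′ → n′ :* con (+ 0) :- con (+ 0) :* d′ := con (+ 0)) refl n (dₖ j) ⟩
      0#                                                    ∎

    dₖ-lowerEntry : ∀ q (k j : Fin r) → dₖ k * lowerEntry q k j ≈ lowerEntry (dₖ j • q ⊝ D q) k j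
    dₖ-lowerEntry q k j = trans (lowerEntry-• (dₖ k) q k j) (lowerEntry-cong (dₖ k • q) (dₖ j • q ⊝ D q) k j (λ j≤k → begin
      dₖ k * q (K ∸ J)                       ≈⟨ *-congʳ (dₖk≈dₖj−[k−j] j≤k) ⟩
      (dₖ j − ι (K ∸ J)) * q (K ∸ J)          ≈⟨ solve 3 (λ d t y → (d :- t) :* y := d :* y :- t :* y) refl (dₖ j) (ι (K ∸ J)) (q (K ∸ J)) ⟩
      dₖ j * q (K ∸ J) − ι (K ∸ J) * q (K ∸ J) ∎))
      where
      K J : ℕ
      K = toℕ k
      J = toℕ j
      dₖk≈dₖj−[k−j] : J ≤ K → dₖ k ≈ dₖ j − ι (K ∸ J)
      dₖk≈dₖj−[k−j] J≤K = begin
        ι (r ∸ suc K)                                ≈⟨ ι-∸ r (suc K) (FinP.toℕ<n k) ⟩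
        R − (1# + ι K)                               ≈⟨ solve 4 (λ R′ o k′ j′ → R′ :- (o :+ k′) := (R′ :- (o :+ j′)) :- (k′ :- j′)) refl R 1# (ι K) (ι J) ⟩
        (R − (1# + ι J)) − (ι K − ι J)               ≈⟨ sym (+-cong (ι-∸ r (suc J) (FinP.toℕ<n j)) (-‿cong (ι-∸ K J J≤K))) ⟩
        ι (r ∸ suc J) − ι (K ∸ J)                    ∎

    ζ[n−μ]≈n/r : ∀ j → ¬ (ζden j ≈ 0#) → ζ j * (n − μs j) ≈ n * r⁻¹
    ζ[n−μ]≈n/r j ζden≉0 = trans (*-assoc _ _ _) (*-congˡ (*-cancelˡ R r≉0 (begin
      R * (ζden j ⁻¹ * (n − μs j))       ≈⟨ solve 3 (λ R′ z m → R′ :* (z :* m) := z :* (R′ :* m)) refl R (ζden j ⁻¹) (n − μs j) ⟩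
      ζden j ⁻¹ * (R * (n − μs j))       ≈⟨ *-congˡ R[n−μ]≈ζden ⟩
      ζden j ⁻¹ * ζden j                 ≈⟨ ⁻¹-inverseˡ _ ζden≉0 ⟩
      1#                                 ≈⟨ sym (⁻¹-inverse R r≉0) ⟩
      R * r⁻¹                            ∎)))
      where
      R[n−μ]≈ζden : R * (n − μs j) ≈ ζden j
      R[n−μ]≈ζden = begin
        R * (n − dₖ j * r⁻¹)         ≈⟨ solve 4 (λ R′ n′ d ri → R′ :* (n′ :- d :* ri) := R′ :* n′ :- d :* (ri :* R′)) refl R n (dₖ j) r⁻¹ ⟩
        R * n − dₖ j * (r⁻¹ * R)     ≈⟨ +-congˡ (-‿cong (trans (*-congˡ (⁻¹-inverseˡ R r≉0)) (*-identityʳ _))) ⟩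
        R * n − dₖ j                 ∎

    R₁·QZ-term : ∀ i k j → R₁ i k * (Qmat s μs · diag ζ) k j ≈
                 ζ j * (n * (lowerEntry (ρ R) i k * lowerEntry (φ^ μs j) k j)
                        − lowerEntry (φ s) i k * lowerEntry (dₖ j • φ^ μs j ⊝ D (φ^ μs j)) k j)
    R₁·QZ-term i k j = begin
      R₁ i k * (Qmat s μs · diag ζ) k j
        ≈⟨ *-cong (R₁-entry i k) (sumFin-*-diag (λ l → Qmat s μs k l) ζ j) ⟩
      (n * ρᵢₖ − φᵢₖ * dₖ k) * (qₖⱼ * ζ j)
        ≈⟨ solve 6 (λ n′ a b d c z → (n′ :* a :- b :* d) :* (c :* z) := z :* (n′ :* (a :* c) :- b :* (d :* c)))
                   refl n ρᵢₖ φᵢₖ (dₖ k) qₖⱼ (ζ j) ⟩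
      ζ j * (n * (ρᵢₖ * qₖⱼ) − φᵢₖ * (dₖ k * qₖⱼ))
        ≈⟨ *-congˡ (+-congˡ (-‿cong (*-congˡ (dₖ-lowerEntry (φ^ μs j) k j)))) ⟩
      ζ j * (n * (ρᵢₖ * qₖⱼ) − φᵢₖ * lowerEntry (dₖ j • φ^ μs j ⊝ D (φ^ μs j)) k j) ∎
      where
      ρᵢₖ φᵢₖ qₖⱼ : Carrier
      ρᵢₖ = lowerEntry (ρ R) i k
      φᵢₖ = lowerEntry (φ s) i k
      qₖⱼ = lowerEntry (φ^ μs j) k j

    R₁·QZ≈nM : (∀ j → ¬ (ζden j ≈ 0#)) → (R₁ · (Qmat s μs · diag ζ)) ≈M scal n M
    R₁·QZ≈nM ζden≉0 i j = begin
      sumFin (λ k → R₁ i k * (Qmat s μs · diag ζ) k j)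
        ≈⟨ sumFin-cong {r} (λ k → R₁·QZ-term i k j) ⟩
      sumFin (λ k → ζ j * (n * (lowerEntry (ρ R) i k * lowerEntry q k j) − lowerEntry (φ s) i k * lowerEntry w k j))
        ≈⟨ trans (sumFin-*ˡ {r} (ζ j) _) (*-congˡ (trans (sumFin-− {r} _ _) (+-congʳ (sumFin-*ˡ {r} n _)))) ⟩
      ζ j * (n * sumFin (λ k → lowerEntry (ρ R) i k * lowerEntry q k j) − sumFin (λ k → lowerEntry (φ s) i k * lowerEntry w k j))
        ≈⟨ *-congˡ (+-cong (*-congˡ (sumFin-lowerEntry (ρ R) q i j)) (-‿cong (sumFin-lowerEntry (φ s) w i j))) ⟩
      ζ j * (n * lowerEntry (ρ R ⊛ q) i j − lowerEntry (φ s ⊛ w) i j)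
        ≈⟨ *-congˡ (trans (+-congʳ (lowerEntry-• n (ρ R ⊛ q) i j)) (lowerEntry-⊝ (n • (ρ R ⊛ q)) (φ s ⊛ w) i j)) ⟩
      ζ j * lowerEntry (n • (ρ R ⊛ q) ⊝ φ s ⊛ w) i j
        ≈⟨ *-congˡ (lowerEntry-cong (n • (ρ R ⊛ q) ⊝ φ s ⊛ w) ((n − μs j) • (q ⊛ ρ R)) i j
                                    (λ _ → φ^-weighted R (μs j) (dₖ j) n dⱼ≈Rμⱼ (toℕ i ∸ toℕ j))) ⟩
      ζ j * lowerEntry ((n − μs j) • (q ⊛ ρ R)) i j
        ≈⟨ lowerEntry-• (ζ j) ((n − μs j) • (q ⊛ ρ R)) i j ⟩
      lowerEntry (ζ j • ((n − μs j) • (q ⊛ ρ R))) i j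
        ≈⟨ lowerEntry-cong (ζ j • ((n − μs j) • (q ⊛ ρ R))) (n • (r⁻¹ • (q ⊛ ρ R))) i j
                           (λ _ → trans (sym (*-assoc _ _ _)) (trans (*-congʳ (ζ[n−μ]≈n/r j (ζden≉0 j))) (*-assoc _ _ _))) ⟩
      lowerEntry (n • (r⁻¹ • (q ⊛ ρ R))) i j
        ≈⟨ sym (lowerEntry-• n (r⁻¹ • (q ⊛ ρ R)) i j) ⟩
      n * M i j ∎
      where
      q w : Series
      q = φ^ μs j
      w = dₖ j • q ⊝ D q
      dⱼ≈Rμⱼ : dₖ j ≈ R * μs j
      dⱼ≈Rμⱼ = sym (trans (solve 3 (λ R′ d ri → R′ :* (d :* ri) := d :* (ri :* R′)) refl R (dₖ j) r⁻¹)
                          (trans (*-congˡ (⁻¹-inverseˡ R r≉0)) (*-identityʳ _)))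

lemma13 : ∀ {c ℓ : Level} (F : Field0 c ℓ) (r : ℕ) → 2 ≤ r →
          (s : Fin r → FieldDefs.Carrier F) (n : FieldDefs.Carrier F) →
          let open FieldDefs F
              open Lemma13Objects r s n
          in ¬ (n ≈ 0#) → (∀ i → ¬ (ζden i ≈ 0#)) →
             ((R₁ · RHS) ≈M idM) × ((RHS · R₁) ≈M idM)
lemma13 F r@(suc r-1) _ s n n≉0 ζden≉0 = R₁·RHS≈I , lower-rightInverse⇒leftInverse R₁ RHS R₁-lower R₁·RHS≈I
  where
  open FieldDefs F
  open Lemma13Objects r s n
  open Development F
  open R₁Factorisation s n (char0 r-1)
  open import Relation.Binary.Reasoning.Setoid setoid

  QZ P : Mat r
  QZ = Qmat s μs · diag ζ
  P = Pmat s λs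

  R₁·RHS≈I : (R₁ · RHS) ≈M idM
  R₁·RHS≈I i j = begin
    (R₁ · RHS) i j                ≈⟨ scal-·ʳ (n ⁻¹) R₁ (QZ · P) i j ⟩
    n ⁻¹ * (R₁ · (QZ · P)) i j    ≈⟨ *-congˡ (sym (·-assoc R₁ QZ P i j)) ⟩
    n ⁻¹ * ((R₁ · QZ) · P) i j    ≈⟨ *-congˡ (·-congʳ P (R₁·QZ≈nM ζden≉0) i j) ⟩
    n ⁻¹ * (scal n M · P) i j     ≈⟨ *-congˡ (scal-·ˡ n M P i j) ⟩
    n ⁻¹ * (n * (M · P) i j)      ≈⟨ *-congˡ (*-congˡ (M·P≈I i j)) ⟩
    n ⁻¹ * (n * idM i j)          ≈⟨ sym (*-assoc _ _ _) ⟩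
    (n ⁻¹ * n) * idM i j          ≈⟨ trans (*-congʳ (⁻¹-inverseˡ n n≉0)) (*-identityˡ _) ⟩
    idM i j                       ∎
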